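{- For the process defined in the context, let $t\geq1$ and $\emptyset\neq\mathcal I^*\subset\{1,\ldots,m\}\times\{1,\ldots,k\}$. Let $\mathcal E_t^*(\mathcal I^*)$ be the event that $|\Phi_{ij}|=|\Phi_{i_tj_t}|\notin\mathcal A_{t-1}\cup\mathcal N_{t-1}$ for all $(i,j)\in\mathcal I^*$ and $(i_t,j_t)\notin\mathcal I^*$. Then almost surely $$\Pr\big[\mathcal E_t^*(\mathcal I^*)\,\big|\,\mathcal F_{t-1}\big]\leq\max\{1,|V\setminus(\mathcal A_{t-1}\cup\mathcal N_{t-1})|\}^{ -|\mathcal I^*|}.$$
   Context: Setting: $k\geq k_0$ for a sufficiently large constant $k_0$, $k^{ -2}\leq\rho<1/25$, $m=\lceil\rho 2^k n/k\rceil$, $\lambda=\sqrt k$, $k_1=0.49k$. $\Phi=\Phi_1\wedge\cdots\wedge\Phi_m$ is a uniformly random $k$-CNF over $V=\{x_1,\ldots,x_n\}$: an ordered $m$-tuple of clauses $\Phi_i=\Phi_{i1}\vee\cdots\vee\Phi_{ik}$ whose $km$ literals are independent uniform over the $2n$ literals. $|l|$ is the variable of literal $l$, $\mathrm{sign}(l)=\pm1$ according as $l$ is positive/negative. For $S\subset V$, $\Phi_i$ is $S$-negative if $|\Phi_{ij}|\in S$ for every $j$ with $\mathrm{sign}(\Phi_{ij})=1$. Process: $\sigma_0\equiv 1$, $\mathcal A_0=\mathcal N_0=\mathcal Z_0=\emptyset$, $\pi_0(i,j)=\mathrm{sign}(\Phi_{ij})$. For $t=1,2,\ldots$: (PI0)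 if $\sigma_{t-1}$ satisfies $\Phi$, stop (stopping time $T$). (PI1) choose $i_t$ uniformly among indices of clauses unsatisfied under $\sigma_{t-1}$ and $j_t\in\{1,\ldots,k\}$ uniformly; $\sigma_t$ is $\sigma_{t-1}$ with the value of $y_t=|\Phi_{i_tj_t}|$ flipped. (PI2) set $\mathcal Z_t=\mathcal Z_{t-1}$, $\mathcal N_t=\mathcal N_{t-1}$; while there is $i\notin\mathcal Z_t$ such that $\Phi_i$ is $(\mathcal A_{t-1}\cup\mathcal N_t\cup\{y_t\})$-negative and either at least $k_1$ indices $j$ have $|\Phi_{ij}|\in\mathcal A_{t-1}\cup\{y_t\}$ or more than $\lambda$ indices $j$ have $|\Phi_{ij}|\in\mathcal N_t$, add the least such $i$ to $\mathcal Z_t$ and all variables of $\Phi_i$ to $\mathcal N_t$. (PI3) $\mathcal A_t=(\mathcal A_{t-1}\cup\{y_t\})\setminus\mathcal N_t$, and $\pi_t(i,j)=\Phi_{ij}$ if $|\Phi_{ij}|\in\mathcal A_t\cup\mathcal N_t$, $\pi_t(i,j)=\mathrm{sign}(\Phi_{ij})$ otherwise. For $t>T$ all quantities (including $\pi_t$) are frozen at their time-$T$ values. $\mathcal F_t$ is the $\sigma$-algebra generated by the random variables $i_s,j_s$ and $\pi_s(i,j)$ for $s\leq t$ and all $(i,j)$.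
   Formalization: The parameter ρ ranges over the rationals. -}

module Defs where

open import Data.Bool using (Bool; true; false; if_then_else_; not; _∧_; _∨_)
import Data.Bool.Properties as BoolP
open import Data.Nat as ℕ using (ℕ; zero; suc; _+_; _*_; _^_; _≤ᵇ_; _<ᵇ_)
open import Data.Integer using (+_)
open import Data.Rational as ℚ using (ℚ; 0ℚ; 1ℚ; _/_)
open import Data.Fin using (Fin; zero; suc)
import Data.Fin.Properties as FinP
open import Data.Fin.Subset using (Subset; _∪_; ⁅_⁆; ∁; ∣_∣; _─_)
import Data.Fin.Subset as Sub
open import Data.Vec as Vec using (Vec; []; _∷_; lookup; tabulate)
import Data.Vec.Properties as VecP
open import Data.List as List using (List; []; _∷_; allFin; concatMap; foldr; cartesianProduct)
open import Data.Bool.ListAction using (and; or)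
open import Data.Nat.ListAction using (sum)
import Data.List.Properties as ListP
open import Data.Maybe using (Maybe; just; nothing; maybe′)
import Data.Maybe.Properties as MaybeP
open import Data.Product using (_×_; _,_; proj₁; proj₂)
import Data.Product.Properties as ProdP
open import Data.Sum using (_⊎_; inj₁; inj₂)
import Data.Sum.Properties as SumP
open import Relation.Nullary.Decidable using (⌊_⌋)
open import Relation.Binary.Definitions using (DecidableEquality)

-- 1/d as a rational, with the (never used in a meaningful way) convention 1/0 = 0
inv : ℕ → ℚ
inv zero    = 0ℚ
inv (suc d) = + 1 / suc d

ℕtoℚ : ℕ → ℚ
ℕtoℚ x = + x / 1

countFin : ∀ {k} → (Fin k → Bool) → ℕ
countFin {k} p = sum (List.map (λ j → if p j then 1 else 0) (allFin k))

allF : ∀ {k} → (Fin k → Bool) → Bool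
allF {k} p = and (List.map p (allFin k))

anyF : ∀ {k} → (Fin k → Bool) → Bool
anyF {k} p = or (List.map p (allFin k))

firstFin : ∀ {m} → (Fin m → Bool) → Maybe (Fin m)
firstFin {zero}  p = nothing
firstFin {suc m} p = if p zero then just zero else Data.Maybe.map suc (firstFin (λ i → p (suc i)))
  where import Data.Maybe

consF : ∀ {A : Set} {m} → A → (Fin m → A) → Fin (suc m) → A
consF x f zero    = x
consF x f (suc i) = f i

allFuns : ∀ {A : Set} m → List A → List (Fin m → A)
allFuns zero    xs = (λ ()) ∷ []
allFuns (suc m) xs = concatMap (λ x → List.map (consF x) (allFuns m xs)) xs

allVecs : ∀ {A : Set} t → List A → List (Vec A t)
allVecs zero    xs = [] ∷ []
allVecs (suc t) xs = concatMap (λ x → List.map (x ∷_) (allVecs t xs)) xs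

Σℚ : ∀ {A : Set} → List A → (A → ℚ) → ℚ
Σℚ xs f = foldr (λ x r → f x ℚ.+ r) 0ℚ xs

-- Literals, formulas, assignments.
-- A literal over V = {x_1..x_n} is (variable , sign) with sign true = positive.

Lit : ℕ → Set
Lit n = Fin n × Bool

allLits : ∀ n → List (Lit n)
allLits n = cartesianProduct (allFin n) (true ∷ false ∷ [])

Formula : ℕ → ℕ → ℕ → Set
Formula n m k = Fin m → Fin k → Lit n

allFormulas : ∀ n m k → List (Formula n m k)
allFormulas n m k = allFuns m (allFuns k (allLits n))

-- entries of π: either the literal itself (revealed) or only its sign
PiEntry : ℕ → Set
PiEntry n = Lit n ⊎ Bool

-- a choice (i_t , j_t); nothing = no step (process already stopped)
Choice : ℕ → ℕ → Set
Choice m k = Maybe (Fin m × Fin k)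

allChoices : ∀ m k → List (Choice m k)
allChoices m k = nothing ∷ List.map just (cartesianProduct (allFin m) (allFin k))

-- observation at time s : (frozen) last choice and π_s (as a matrix)
Obs : ℕ → ℕ → ℕ → Set
Obs n m k = Choice m k × Vec (Vec (PiEntry n) k) m

_≟Obs_ : ∀ {n m k} → DecidableEquality (Obs n m k)
_≟Obs_ = ProdP.≡-dec (MaybeP.≡-dec (ProdP.≡-dec FinP._≟_ FinP._≟_))
                     (VecP.≡-dec (VecP.≡-dec (SumP.≡-dec (ProdP.≡-dec FinP._≟_ BoolP._≟_) BoolP._≟_)))

_≟Hist_ : ∀ {n m k} → DecidableEquality (List (Obs n m k))
_≟Hist_ = ListP.≡-dec _≟Obs_

record State (n m k : ℕ) : Set where
  field
    σ    : Fin n → Bool                 -- σ_t (true = value 1)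
    A    : Subset n
    N    : Subset n
    Z    : Subset m
    last : Choice m k                   -- (i_t , j_t), frozen after T; nothing at t = 0
    π    : Fin m → Fin k → PiEntry n

module Walk {n m k : ℕ} (Φ : Formula n m k) where
  open State

  var : Fin m → Fin k → Fin n
  var i j = proj₁ (Φ i j)

  sgn : Fin m → Fin k → Bool
  sgn i j = proj₂ (Φ i j)

  litSat : (Fin n → Bool) → Lit n → Bool
  litSat σ (x , b) = if b then σ x else not (σ x)

  clauseSat : (Fin n → Bool) → Fin m → Bool
  clauseSat σ i = anyF (λ j → litSat σ (Φ i j))

  formSat : (Fin n → Bool) → Bool
  formSat σ = allF (clauseSat σ)

  unsat : (Fin n → Bool) → ℕ
  unsat σ = countFin (λ i → not (clauseSat σ i))

  negative : Subset n → Fin m → Bool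
  negative S i = allF (λ j → not (sgn i j) ∨ lookup S (var i j))

  varsOf : Fin m → Subset n
  varsOf i = foldr (λ j S → ⁅ var i j ⁆ ∪ S) Sub.⊥ (allFin k)

  -- the condition of (PI2) for clause i, given 𝒜_{t-1}, y_t and the current 𝒵_t, 𝒩_t.
  -- "at least k₁ = 0.49k indices": 49k ≤ 100·c ;  "more than λ = √k indices": k < c²
  cand : Subset n → Fin n → Subset m → Subset n → Fin m → Bool
  cand A y Z N i =
    not (lookup Z i)
    ∧ negative (A ∪ N ∪ ⁅ y ⁆) i
    ∧ ( ((49 * k) ≤ᵇ (100 * countFin (λ j → lookup (A ∪ ⁅ y ⁆) (var i j))))
      ∨ (k <ᵇ (countFin (λ j → lookup N (var i j)) * countFin (λ j → lookup N (var i j)))) )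

  -- the while loop of (PI2); each iteration adds a new index to 𝒵, so m iterations suffice
  loop : ℕ → Subset n → Fin n → Subset m → Subset n → Subset m × Subset n
  loop zero    A y Z N = Z , N
  loop (suc f) A y Z N =
    maybe′ (λ i → loop f A y (Z ∪ ⁅ i ⁆) (N ∪ varsOf i)) (Z , N) (firstFin (cand A y Z N))

  flip : (Fin n → Bool) → Fin n → Fin n → Bool
  flip σ y x = if ⌊ x FinP.≟ y ⌋ then not (σ x) else σ x

  initial : State n m k
  initial = record
    { σ = λ _ → true ; A = Sub.⊥ ; N = Sub.⊥ ; Z = Sub.⊥ ; last = nothing
    ; π = λ i j → inj₂ (sgn i j) }

  step : State n m k → Choice m k → State n m k
  step s nothing = s
  step s (just (i , j)) =
    if formSat (σ s) then s else
      let y   = var i j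
          ZN  = loop m (A s) y (Z s) (N s)
          Z'  = proj₁ ZN
          N'  = proj₂ ZN
          A'  = (A s ∪ ⁅ y ⁆) ─ N'
      in record
        { σ = flip (σ s) y ; A = A' ; N = N' ; Z = Z' ; last = just (i , j)
        ; π = λ i' j' → if lookup (A' ∪ N') (var i' j') then inj₁ (Φ i' j') else inj₂ (sgn i' j') }

  -- probability of a choice at the next step, given the current state:
  -- if stopped, the (dummy) choice `nothing` has probability 1; otherwise (i,j) is uniform
  -- over unsatisfied clauses i and j ∈ {1..k}
  stepW : State n m k → Choice m k → ℚ
  stepW s nothing = if formSat (σ s) then 1ℚ else 0ℚ
  stepW s (just (i , j)) =
    if formSat (σ s) then 0ℚ else
    if clauseSat (σ s) i then 0ℚ else inv (unsat (σ s) * k)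

  runFrom : State n m k → List (Choice m k) → State n m k
  runFrom s []       = s
  runFrom s (c ∷ cs) = runFrom (step s c) cs

  traceFrom : State n m k → List (Choice m k) → List (State n m k)
  traceFrom s []       = s ∷ []
  traceFrom s (c ∷ cs) = s ∷ traceFrom (step s c) cs

  weightFrom : State n m k → List (Choice m k) → ℚ
  weightFrom s []       = 1ℚ
  weightFrom s (c ∷ cs) = stepW s c ℚ.* weightFrom (step s c) cs

  obs : State n m k → Obs n m k
  obs s = last s , tabulate (λ i → tabulate (λ j → π s i j))

-- The finite probability space for the first t steps:
-- outcomes ω = (Φ , (c_1 , … , c_t)).

Ω : ℕ → ℕ → ℕ → ℕ → Set
Ω n m k t = Formula n m k × Vec (Choice m k) t

allΩ : ∀ n m k t → List (Ω n m k t)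
allΩ n m k t = cartesianProduct (allFormulas n m k) (allVecs t (allChoices m k))

-- Pr[ω] : Φ uniform over the (2n)^{km} formulas, then the walk's choices
weight : ∀ {n m k t} → Ω n m k t → ℚ
weight {n} {m} {k} (Φ , cs) =
  inv ((2 * n) ^ (k * m)) ℚ.* Walk.weightFrom Φ (Walk.initial Φ) (Vec.toList cs)

Pr : ∀ {n m k t} → (Ω n m k t → Bool) → ℚ
Pr {n} {m} {k} {t} E = Σℚ (allΩ n m k t) (λ ω → if E ω then weight ω else 0ℚ)

stateAt : ∀ {n m k t} → ℕ → Ω n m k t → State n m k
stateAt s (Φ , cs) = Walk.runFrom Φ (Walk.initial Φ) (List.take s (Vec.toList cs))

-- the history (i_s , j_s , π_s)_{s ≤ r} generating ℱ_r
history : ∀ {n m k t} → ℕ → Ω n m k t → List (Obs n m k)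
history r (Φ , cs) = List.map (Walk.obs Φ) (Walk.traceFrom Φ (Walk.initial Φ) (List.take r (Vec.toList cs)))

-- the atom of ℱ_r containing ω
sameHist : ∀ {n m k t} → ℕ → Ω n m k t → Ω n m k t → Bool
sameHist r ω ω' = ⌊ history r ω' ≟Hist history r ω ⌋

IndexSet : ℕ → ℕ → Set
IndexSet m k = Fin m → Fin k → Bool

size : ∀ {m k} → IndexSet m k → ℕ
size {m} I = sum (List.map (λ i → countFin (I i)) (allFin m))

NonEmpty : ∀ {m k} → IndexSet m k → Set
NonEmpty {m} {k} I = Data.Product.Σ (Fin m × Fin k) (λ p → I (proj₁ p) (proj₂ p) ≡ true)
  where open import Relation.Binary.PropositionalEquality using (_≡_)
        import Data.Product

Estar : ∀ {n m k t} → ℕ → IndexSet m k → Ω n m k t → Bool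
Estar {n} {m} {k} t I ω@(Φ , cs) with State.last (stateAt t ω)
... | nothing = false
... | just (it , jt) =
  let x   = Walk.var Φ it jt
      Sp  = stateAt (t ℕ.∸ 1) ω
  in allF (λ i → allF (λ j → not (I i j) ∨ ⌊ Walk.var Φ i j FinP.≟ x ⌋))
     ∧ not (lookup (State.A Sp ∪ State.N Sp) x)
     ∧ not (I it jt)

bound : ∀ {n m k t} → ℕ → Ω n m k t → ℕ
bound t ω = ℕ._⊔_ 1 ∣ ∁ (State.A (stateAt (t ℕ.∸ 1) ω) ∪ State.N (stateAt (t ℕ.∸ 1) ω)) ∣

-- Condition on the history up to time t − 1.  On ℰ*_t(ℐ*) every position in ℐ* carries the variable
-- y_t flipped at time t, and y_t ∉ 𝒜_{t−1} ∪ 𝒩_{t−1}; so up to time t − 1 the walk has seen only the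
-- signs at these positions, and at time t only σ, in which all unrevealed variables are still true.
-- Replacing the variables at ℐ* by arbitrary variables outside 𝒜_{t−1} ∪ 𝒩_{t−1} therefore gives an
-- outcome with the same probability and the same history.  As (i_t, j_t) ∉ ℐ*, the original outcome and
-- the chosen variables can be read back from the switched one, so the event, with each outcome counted
-- |V ∖ (𝒜_{t−1} ∪ 𝒩_{t−1})|^|ℐ*| times, injects into the conditioning event.

module Submission where

module Sums where

  open import Algebra.Bundles using (CommutativeMonoid)
  open import Data.Bool using (Bool; true; false; if_then_else_; not)
  open import Data.Fin using (Fin; zero; suc)
  open import Data.Fin.Subset using (Subset; ∁; ∣_∣)
  open import Data.Integer as ℤ using ()
  import Data.Integer.Properties as ℤ
  open import Data.List using (List; []; _∷_; _++_; map; concatMap; cartesianProduct; allFin; filterᵇ)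
  open import Data.List.Properties using (map-tabulate)
  open import Data.List.Membership.Propositional using (_∈_; find)
  open import Data.List.Membership.Propositional.Properties using (∈-concatMap⁻; ∈-map⁻)
  open import Data.List.Relation.Unary.Any using (here; there)
  open import Data.Nat as ℕ using (ℕ; zero; suc; _^_)
  import Data.Nat.Properties as ℕ
  open import Data.Nat.ListAction using (sum)
  open import Data.Product using (_×_; _,_)
  open import Data.Rational using (ℚ; 0ℚ; 1ℚ; _+_; _*_; _≤_; nonNegative; toℚᵘ)
  open import Data.Rational.Properties
  open import Data.Rational.Unnormalised as ℚᵘ using (mkℚᵘ; *≡*)
  import Data.Rational.Unnormalised.Properties as ℚᵘ
  open import Data.Vec using ([]; _∷_; lookup)
  open import Function using (_∘_; id)
  open import Relation.Binary.PropositionalEquality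
  open import Defs using (Σℚ; ℕtoℚ; allFuns; consF)
  open import Algebra.Properties.CommutativeSemigroup
    (CommutativeMonoid.commutativeSemigroup +-0-commutativeMonoid) using (interchange)

  private variable
    A B : Set
    m n : ℕ

  Σℚ-++ : (xs ys : List A) (f : A → ℚ) → Σℚ (xs ++ ys) f ≡ Σℚ xs f + Σℚ ys f
  Σℚ-++ []       ys f = sym (+-identityˡ _)
  Σℚ-++ (x ∷ xs) ys f = trans (cong (f x +_) (Σℚ-++ xs ys f)) (sym (+-assoc (f x) _ _))

  Σℚ-map : (g : A → B) (xs : List A) (f : B → ℚ) → Σℚ (map g xs) f ≡ Σℚ xs (f ∘ g)
  Σℚ-map g []       f = refl
  Σℚ-map g (x ∷ xs) f = cong (f (g x) +_) (Σℚ-map g xs f)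

  Σℚ-concatMap : (g : A → List B) (xs : List A) (f : B → ℚ) →
                 Σℚ (concatMap g xs) f ≡ Σℚ xs (λ x → Σℚ (g x) f)
  Σℚ-concatMap g []       f = refl
  Σℚ-concatMap g (x ∷ xs) f =
    trans (Σℚ-++ (g x) (concatMap g xs) f) (cong (Σℚ (g x) f +_) (Σℚ-concatMap g xs f))

  Σℚ-cartesianProduct : (xs : List A) (ys : List B) (f : A × B → ℚ) →
                        Σℚ (cartesianProduct xs ys) f ≡ Σℚ xs (λ x → Σℚ ys (λ y → f (x , y)))
  Σℚ-cartesianProduct []       ys f = refl
  Σℚ-cartesianProduct (x ∷ xs) ys f =
    trans (Σℚ-++ (map (x ,_) ys) _ f) (cong₂ _+_ (Σℚ-map (x ,_) ys f) (Σℚ-cartesianProduct xs ys f))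

  Σℚ-cong : (xs : List A) {f g : A → ℚ} → (∀ x → f x ≡ g x) → Σℚ xs f ≡ Σℚ xs g
  Σℚ-cong []       f≗g = refl
  Σℚ-cong (x ∷ xs) f≗g = cong₂ _+_ (f≗g x) (Σℚ-cong xs f≗g)

  Σℚ-mono-∈ : (xs : List A) {f g : A → ℚ} → (∀ x → x ∈ xs → f x ≤ g x) → Σℚ xs f ≤ Σℚ xs g
  Σℚ-mono-∈ []       f≤g = ≤-refl
  Σℚ-mono-∈ (x ∷ xs) f≤g = +-mono-≤ (f≤g x (here refl)) (Σℚ-mono-∈ xs (λ y y∈xs → f≤g y (there y∈xs)))

  Σℚ-mono : (xs : List A) {f g : A → ℚ} → (∀ x → f x ≤ g x) → Σℚ xs f ≤ Σℚ xs g
  Σℚ-mono xs f≤g = Σℚ-mono-∈ xs (λ x _ → f≤g x)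

  Σℚ-0 : (xs : List A) → Σℚ xs (λ _ → 0ℚ) ≡ 0ℚ
  Σℚ-0 []       = refl
  Σℚ-0 (x ∷ xs) = trans (+-identityˡ _) (Σℚ-0 xs)

  Σℚ-nonNeg : (xs : List A) {f : A → ℚ} → (∀ x → 0ℚ ≤ f x) → 0ℚ ≤ Σℚ xs f
  Σℚ-nonNeg xs 0≤f = ≤-trans (≤-reflexive (sym (Σℚ-0 xs))) (Σℚ-mono xs 0≤f)

  Σℚ-*ʳ : (xs : List A) (f : A → ℚ) (c : ℚ) → Σℚ xs f * c ≡ Σℚ xs (λ x → f x * c)
  Σℚ-*ʳ []       f c = *-zeroˡ c
  Σℚ-*ʳ (x ∷ xs) f c = trans (*-distribʳ-+ c (f x) _) (cong (f x * c +_) (Σℚ-*ʳ xs f c))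

  Σℚ-*ˡ : (xs : List A) (f : A → ℚ) (c : ℚ) → c * Σℚ xs f ≡ Σℚ xs (λ x → c * f x)
  Σℚ-*ˡ []       f c = *-zeroʳ c
  Σℚ-*ˡ (x ∷ xs) f c = trans (*-distribˡ-+ c (f x) _) (cong (c * f x +_) (Σℚ-*ˡ xs f c))

  Σℚ-+ : (xs : List A) (f g : A → ℚ) → Σℚ xs (λ x → f x + g x) ≡ Σℚ xs f + Σℚ xs g
  Σℚ-+ []       f g = refl
  Σℚ-+ (x ∷ xs) f g = trans (cong (f x + g x +_) (Σℚ-+ xs f g)) (interchange (f x) (g x) _ _)

  Σℚ-swap : (xs : List A) (ys : List B) (f : A → B → ℚ) →
            Σℚ xs (λ x → Σℚ ys (f x)) ≡ Σℚ ys (λ y → Σℚ xs (λ x → f x y))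
  Σℚ-swap []       ys f = sym (Σℚ-0 ys)
  Σℚ-swap (x ∷ xs) ys f =
    trans (cong (Σℚ ys (f x) +_) (Σℚ-swap xs ys f)) (sym (Σℚ-+ ys (f x) (λ y → Σℚ xs (λ x → f x y))))

  Σℚ-filterᵇ : (p : A → Bool) (xs : List A) (f : A → ℚ) →
               Σℚ (filterᵇ p xs) f ≡ Σℚ xs (λ x → if p x then f x else 0ℚ)
  Σℚ-filterᵇ p []       f = refl
  Σℚ-filterᵇ p (x ∷ xs) f with p x
  ... | true  = cong (f x +_) (Σℚ-filterᵇ p xs f)
  ... | false = trans (Σℚ-filterᵇ p xs f) (sym (+-identityˡ _))

  map-allFin-suc : (f : Fin (suc n) → A) → map f (allFin (suc n)) ≡ f zero ∷ map (f ∘ suc) (allFin n)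
  map-allFin-suc {n} f = cong (f zero ∷_) (trans (map-tabulate suc f) (sym (map-tabulate id (f ∘ suc))))

  Σℚ-allFin-suc : (f : Fin (suc n) → ℚ) → Σℚ (allFin (suc n)) f ≡ f zero + Σℚ (allFin n) (f ∘ suc)
  Σℚ-allFin-suc {n} f =
    cong (f zero +_) (trans (cong (λ xs → Σℚ xs f) (sym (map-tabulate id suc))) (Σℚ-map suc (allFin n) f))

  0≤1 : 0ℚ ≤ 1ℚ
  0≤1 = nonNegative⁻¹ 1ℚ

  *-nonNeg : ∀ {p q} → 0ℚ ≤ p → 0ℚ ≤ q → 0ℚ ≤ p * q
  *-nonNeg {p} {q} 0≤p 0≤q =
    nonNegative⁻¹ (p * q) {{nonNeg*nonNeg⇒nonNeg p {{nonNegative 0≤p}} q {{nonNegative 0≤q}}}}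

  ∏ : ∀ m → (Fin m → ℚ) → ℚ
  ∏ zero    f = 1ℚ
  ∏ (suc m) f = f zero * ∏ m (f ∘ suc)

  ∏-cong : ∀ m {f g : Fin m → ℚ} → (∀ i → f i ≡ g i) → ∏ m f ≡ ∏ m g
  ∏-cong zero    f≗g = refl
  ∏-cong (suc m) f≗g = cong₂ _*_ (f≗g zero) (∏-cong m (f≗g ∘ suc))

  ∏-1 : ∀ m → ∏ m (λ _ → 1ℚ) ≡ 1ℚ
  ∏-1 zero    = refl
  ∏-1 (suc m) = trans (*-identityˡ _) (∏-1 m)

  ∏-nonNeg : ∀ m {f : Fin m → ℚ} → (∀ i → 0ℚ ≤ f i) → 0ℚ ≤ ∏ m f
  ∏-nonNeg zero    0≤f = 0≤1
  ∏-nonNeg (suc m) 0≤f = *-nonNeg (0≤f zero) (∏-nonNeg m (0≤f ∘ suc))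

  ∏-≤1 : ∀ m {f : Fin m → ℚ} → (∀ i → 0ℚ ≤ f i) → (∀ i → f i ≤ 1ℚ) → ∏ m f ≤ 1ℚ
  ∏-≤1 zero    0≤f f≤1 = ≤-refl
  ∏-≤1 (suc m) {f} 0≤f f≤1 = begin
    f zero * ∏ m (f ∘ suc) ≤⟨ *-monoˡ-≤-nonNeg (f zero) {{nonNegative (0≤f zero)}} (∏-≤1 m (0≤f ∘ suc) (f≤1 ∘ suc)) ⟩
    f zero * 1ℚ            ≡⟨ *-identityʳ (f zero) ⟩
    f zero                 ≤⟨ f≤1 zero ⟩
    1ℚ                     ∎
    where open ≤-Reasoning

  allFunsIn : ∀ m → (Fin m → List A) → List (Fin m → A)
  allFunsIn zero    opts = allFuns zero []
  allFunsIn (suc m) opts = concatMap (λ x → map (consF x) (allFunsIn m (opts ∘ suc))) (opts zero)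

  -- The base case is borrowed from allFuns so that the two enumerations agree definitionally there.
  allFuns≡allFunsIn : ∀ m (xs : List A) → allFuns m xs ≡ allFunsIn m (λ _ → xs)
  allFuns≡allFunsIn zero    xs = refl
  allFuns≡allFunsIn (suc m) xs = cong (λ fs → concatMap (λ x → map (consF x) fs) xs) (allFuns≡allFunsIn m xs)

  Σℚ-allFunsIn-∏ : ∀ m (opts : Fin m → List A) (F : Fin m → A → ℚ) →
    Σℚ (allFunsIn m opts) (λ f → ∏ m (λ i → F i (f i))) ≡ ∏ m (λ i → Σℚ (opts i) (F i))
  Σℚ-allFunsIn-∏ zero    opts F = +-identityʳ 1ℚ
  Σℚ-allFunsIn-∏ {A = A} (suc m) opts F = begin
    Σℚ (concatMap extend (opts zero)) P
      ≡⟨ Σℚ-concatMap extend (opts zero) P ⟩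
    Σℚ (opts zero) (λ x → Σℚ (map (consF x) fs) P)
      ≡⟨ Σℚ-cong (opts zero) (λ x → trans (Σℚ-map (consF x) fs P) (sym (Σℚ-*ˡ fs Q (F zero x)))) ⟩
    Σℚ (opts zero) (λ x → F zero x * Σℚ fs Q)
      ≡⟨ Σℚ-cong (opts zero) (λ x → cong (F zero x *_) (Σℚ-allFunsIn-∏ m (opts ∘ suc) (F ∘ suc))) ⟩
    Σℚ (opts zero) (λ x → F zero x * rest)
      ≡⟨ Σℚ-*ʳ (opts zero) (F zero) rest ⟨
    Σℚ (opts zero) (F zero) * rest ∎
    where
    open ≡-Reasoning
    fs : List (Fin m → A)
    fs = allFunsIn m (opts ∘ suc)
    extend : A → List (Fin (suc m) → A)
    extend x = map (consF x) fs
    P : (Fin (suc m) → A) → ℚ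
    P f = ∏ (suc m) (λ i → F i (f i))
    Q : (Fin m → A) → ℚ
    Q f = ∏ m (λ i → F (suc i) (f i))
    rest : ℚ
    rest = ∏ m (λ i → Σℚ (opts (suc i)) (F (suc i)))

  ∈-allFunsIn : ∀ m (opts : Fin m → List A) {f} → f ∈ allFunsIn m opts → ∀ i → f i ∈ opts i
  ∈-allFunsIn (suc m) opts f∈ i
    with x , x∈opts₀ , f∈extend ← find (∈-concatMap⁻ (λ x → map (consF x) (allFunsIn m (opts ∘ suc)))
                                                     {xs = opts zero} f∈)
    with g , g∈ , refl ← ∈-map⁻ (consF x) f∈extend
    with i
  ... | zero  = x∈opts₀
  ... | suc i = ∈-allFunsIn m (opts ∘ suc) g∈ i

  toℚᵘ-ℕtoℚ : ∀ a → toℚᵘ (ℕtoℚ a) ℚᵘ.≃ mkℚᵘ (ℤ.+ a) 0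
  toℚᵘ-ℕtoℚ a = toℚᵘ-fromℚᵘ (mkℚᵘ (ℤ.+ a) 0)

  ℕtoℚ-+ : ∀ a b → ℕtoℚ (a ℕ.+ b) ≡ ℕtoℚ a + ℕtoℚ b
  ℕtoℚ-+ a b = toℚᵘ-injective (begin-equality
    toℚᵘ (ℕtoℚ (a ℕ.+ b))                  ≃⟨ toℚᵘ-ℕtoℚ (a ℕ.+ b) ⟩
    mkℚᵘ (ℤ.+ (a ℕ.+ b)) 0                 ≃⟨ *≡* (cong (ℤ._* ℤ.+ 1) (sym +a+b)) ⟩
    mkℚᵘ (ℤ.+ a) 0 ℚᵘ.+ mkℚᵘ (ℤ.+ b) 0     ≃⟨ ℚᵘ.+-cong (toℚᵘ-ℕtoℚ a) (toℚᵘ-ℕtoℚ b) ⟨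
    toℚᵘ (ℕtoℚ a) ℚᵘ.+ toℚᵘ (ℕtoℚ b)       ≃⟨ toℚᵘ-homo-+ (ℕtoℚ a) (ℕtoℚ b) ⟨
    toℚᵘ (ℕtoℚ a + ℕtoℚ b)                 ∎)
    where
    open ℚᵘ.≤-Reasoning
    +a+b : ℤ.+ a ℤ.* ℤ.+ 1 ℤ.+ ℤ.+ b ℤ.* ℤ.+ 1 ≡ ℤ.+ (a ℕ.+ b)
    +a+b = cong₂ ℤ._+_ (ℤ.*-identityʳ (ℤ.+ a)) (ℤ.*-identityʳ (ℤ.+ b))

  ℕtoℚ-* : ∀ a b → ℕtoℚ (a ℕ.* b) ≡ ℕtoℚ a * ℕtoℚ b
  ℕtoℚ-* a b = toℚᵘ-injective (begin-equality
    toℚᵘ (ℕtoℚ (a ℕ.* b))                  ≃⟨ toℚᵘ-ℕtoℚ (a ℕ.* b) ⟩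
    mkℚᵘ (ℤ.+ (a ℕ.* b)) 0                 ≃⟨ *≡* (cong (ℤ._* ℤ.+ 1) (ℤ.pos-* a b)) ⟩
    mkℚᵘ (ℤ.+ a) 0 ℚᵘ.* mkℚᵘ (ℤ.+ b) 0     ≃⟨ ℚᵘ.*-cong (toℚᵘ-ℕtoℚ a) (toℚᵘ-ℕtoℚ b) ⟨
    toℚᵘ (ℕtoℚ a) ℚᵘ.* toℚᵘ (ℕtoℚ b)       ≃⟨ toℚᵘ-homo-* (ℕtoℚ a) (ℕtoℚ b) ⟨
    toℚᵘ (ℕtoℚ a * ℕtoℚ b)                 ∎)
    where open ℚᵘ.≤-Reasoning

  outside : Subset n → Fin n → ℚ
  outside U v = if not (lookup U v) then 1ℚ else 0ℚ

  ℕtoℚ-∣∁∣ : (U : Subset n) → ℕtoℚ ∣ ∁ U ∣ ≡ Σℚ (allFin n) (outside U)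
  ℕtoℚ-∣∁∣ []                  = refl
  ℕtoℚ-∣∁∣ {suc n} (true ∷ U)  =
    trans (ℕtoℚ-∣∁∣ U) (sym (trans (Σℚ-allFin-suc {n} (outside (true ∷ U))) (+-identityˡ _)))
  ℕtoℚ-∣∁∣ {suc n} (false ∷ U) =
    trans (ℕtoℚ-+ 1 ∣ ∁ U ∣)
          (trans (cong (1ℚ +_) (ℕtoℚ-∣∁∣ U)) (sym (Σℚ-allFin-suc {n} (outside (false ∷ U)))))

  ℕtoℚ-^-sum : ∀ d m (c : Fin m → ℕ) →
               ℕtoℚ (d ^ sum (map c (allFin m))) ≡ ∏ m (λ i → ℕtoℚ (d ^ c i))
  ℕtoℚ-^-sum d zero    c = refl
  ℕtoℚ-^-sum d (suc m) c = begin
    ℕtoℚ (d ^ sum (map c (allFin (suc m))))       ≡⟨ cong (λ xs → ℕtoℚ (d ^ sum xs)) (map-allFin-suc c) ⟩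
    ℕtoℚ (d ^ (c zero ℕ.+ rest))                  ≡⟨ cong ℕtoℚ (ℕ.^-distribˡ-+-* d (c zero) rest) ⟩
    ℕtoℚ (d ^ c zero ℕ.* d ^ rest)                ≡⟨ ℕtoℚ-* (d ^ c zero) (d ^ rest) ⟩
    ℕtoℚ (d ^ c zero) * ℕtoℚ (d ^ rest)           ≡⟨ cong (ℕtoℚ (d ^ c zero) *_) (ℕtoℚ-^-sum d m (c ∘ suc)) ⟩
    ℕtoℚ (d ^ c zero) * ∏ m (λ i → ℕtoℚ (d ^ c (suc i))) ∎
    where
    open ≡-Reasoning
    rest : ℕ
    rest = sum (map (c ∘ suc) (allFin m))

  ℕtoℚ-^-indicator : ∀ d b → ℕtoℚ (d ^ (if b then 1 else 0)) ≡ (if b then ℕtoℚ d else 1ℚ)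
  ℕtoℚ-^-indicator d true  = cong ℕtoℚ (ℕ.*-identityʳ d)
  ℕtoℚ-^-indicator d false = refl

module Counting where

  open import Data.Bool using (Bool; true; false; if_then_else_; _∧_)
  import Data.Bool.Properties as Bool
  open import Data.Bool.Properties using (T-≡)
  open import Data.Fin using (Fin; zero; suc)
  import Data.Fin.Properties as Fin
  open import Data.List using (List; []; _∷_; map; concatMap; cartesianProduct; allFin; filterᵇ)
  open import Data.List.Membership.Propositional using (_∈_)
  open import Data.Maybe using (just; nothing)
  import Data.Maybe.Properties as Maybe
  open import Data.Nat using (ℕ; zero; suc)
  open import Data.Product using (_×_; _,_; uncurry)
  import Data.Product.Properties as Product
  open import Data.Rational using (ℚ; 0ℚ; 1ℚ; _+_; _*_; _≤_; _<_; nonNegative)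
  open import Data.Rational.Properties
  open import Data.Vec using (Vec; []; _∷_)
  import Data.Vec.Properties as Vec
  open import Function using (_∘_; mk⇔; Equivalence)
  open import Relation.Binary.Definitions using (DecidableEquality)
  open import Relation.Binary.PropositionalEquality
  open import Relation.Nullary using (Dec; does; yes; no; _×-dec_)
  open import Relation.Nullary.Decidable using (⌊_⌋; does-⇔; dec-true; toWitness; fromWitness)
  open import Defs using (Σℚ; allFuns; allVecs; allLits; Choice; allChoices)
  open Sums

  private variable
    A B : Set
    m n : ℕ

  𝟙 : Bool → ℚ
  𝟙 true  = 1ℚ
  𝟙 false = 0ℚ

  𝟙-nonNeg : ∀ b → 0ℚ ≤ 𝟙 b
  𝟙-nonNeg true  = 0≤1
  𝟙-nonNeg false = ≤-refl

  𝟙-≤1 : ∀ b → 𝟙 b ≤ 1ℚ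
  𝟙-≤1 true  = ≤-refl
  𝟙-≤1 false = 0≤1

  𝟙-∧ : ∀ a b → 𝟙 (a ∧ b) ≡ 𝟙 a * 𝟙 b
  𝟙-∧ true  b = sym (*-identityˡ (𝟙 b))
  𝟙-∧ false b = sym (*-zeroˡ (𝟙 b))

  𝟙*-nonPos : ∀ b {q} → q ≤ 0ℚ → 𝟙 b * q ≤ 0ℚ
  𝟙*-nonPos true  {q} q≤0 = ≤-trans (≤-reflexive (*-identityˡ q)) q≤0
  𝟙*-nonPos false {q} q≤0 = ≤-reflexive (*-zeroˡ q)

  every : ∀ m → (Fin m → Bool) → Bool
  every zero    p = true
  every (suc m) p = p zero ∧ every m (p ∘ suc)

  every⁺ : ∀ m {p : Fin m → Bool} → (∀ i → p i ≡ true) → every m p ≡ true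
  every⁺ zero    p≡true = refl
  every⁺ (suc m) p≡true rewrite p≡true zero = every⁺ m (p≡true ∘ suc)

  every⁻ : ∀ m {p : Fin m → Bool} → every m p ≡ true → ∀ i → p i ≡ true
  every⁻ (suc m) {p} all i with p zero in p₀ | i
  ... | true | zero  = p₀
  ... | true | suc i = every⁻ m all i

  𝟙-every : ∀ m (p : Fin m → Bool) → 𝟙 (every m p) ≡ ∏ m (𝟙 ∘ p)
  𝟙-every zero    p = refl
  𝟙-every (suc m) p = trans (𝟙-∧ (p zero) _) (cong (𝟙 (p zero) *_) (𝟙-every m (p ∘ suc)))

  ⌊⌋-true⁻ : ∀ {P : Set} (p? : Dec P) → ⌊ p? ⌋ ≡ true → P
  ⌊⌋-true⁻ p? holds = toWitness {a? = p?} (Equivalence.from T-≡ holds)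

  ⌊⌋-true⁺ : ∀ {P : Set} (p? : Dec P) → P → ⌊ p? ⌋ ≡ true
  ⌊⌋-true⁺ p? p = Equivalence.to T-≡ (fromWitness {a? = p?} p)

  -- Equality is tested by Booleans rather than decided, since formulas are functions and can
  -- only be compared pointwise.
  test : DecidableEquality A → A → A → Bool
  test _≟_ a b = does (a ≟ b)

  test-sound : (_≟_ : DecidableEquality A) {a b : A} → test _≟_ a b ≡ true → a ≡ b
  test-sound _≟_ {a} {b} holds with a ≟ b
  ... | yes a≡b = a≡b

  test-refl : (_≟_ : DecidableEquality A) (a : A) → test _≟_ a a ≡ true
  test-refl _≟_ a = dec-true (a ≟ a) refl

  _⊗_ : (A → A → Bool) → (B → B → Bool) → A × B → A × B → Bool
  (eq₁ ⊗ eq₂) (a , b) (a′ , b′) = eq₁ a a′ ∧ eq₂ b b′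

  test-≡-dec-× : (d₁ : DecidableEquality A) (d₂ : DecidableEquality B) (p q : A × B) →
                 test (Product.≡-dec d₁ d₂) p q ≡ (test d₁ ⊗ test d₂) p q
  test-≡-dec-× d₁ d₂ (a , b) (a′ , b′) =
    does-⇔ (mk⇔ Product.,-injective (uncurry (cong₂ _,_)))
           (Product.≡-dec d₁ d₂ (a , b) (a′ , b′)) (d₁ a a′ ×-dec d₂ b b′)

  pointwise : (A → A → Bool) → (Fin m → A) → (Fin m → A) → Bool
  pointwise {m = m} _==_ f g = every m (λ i → f i == g i)

  pointwise²⁺ : ∀ {k} {_==_ : A → A → Bool} → (∀ a → a == a ≡ true) →
                {f g : Fin m → Fin k → A} → (∀ i j → f i j ≡ g i j) → pointwise (pointwise _==_) f g ≡ true
  pointwise²⁺ {m = m} {k} {_==_} ==-refl {f} f≗g =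
    every⁺ m (λ i → every⁺ k (λ j → subst (λ b → f i j == b ≡ true) (f≗g i j) (==-refl (f i j))))

  pointwise²⁻ : ∀ {k} {_==_ : A → A → Bool} → (∀ {a b} → a == b ≡ true → a ≡ b) →
                {f g : Fin m → Fin k → A} → pointwise (pointwise _==_) f g ≡ true → ∀ i j → f i j ≡ g i j
  pointwise²⁻ {m = m} {k} ==-sound f≈g i j = ==-sound (every⁻ k (every⁻ m f≈g i) j)

  mult : (A → A → Bool) → List A → A → ℚ
  mult _==_ xs a = Σℚ xs (λ x → 𝟙 (x == a))

  Enumerates : (A → A → Bool) → List A → Set
  Enumerates _==_ xs = ∀ a → mult _==_ xs a ≡ 1ℚ

  mult-cartesianProduct : (eq₁ : A → A → Bool) (eq₂ : B → B → Bool) (xs : List A) (ys : List B) (a : A) (b : B) →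
    mult (eq₁ ⊗ eq₂) (cartesianProduct xs ys) (a , b) ≡ mult eq₁ xs a * mult eq₂ ys b
  mult-cartesianProduct eq₁ eq₂ xs ys a b = begin
    Σℚ (cartesianProduct xs ys) (λ p → 𝟙 ((eq₁ ⊗ eq₂) p (a , b)))
      ≡⟨ Σℚ-cartesianProduct xs ys (λ p → 𝟙 ((eq₁ ⊗ eq₂) p (a , b))) ⟩
    Σℚ xs (λ x → Σℚ ys (λ y → 𝟙 (eq₁ x a ∧ eq₂ y b)))
      ≡⟨ Σℚ-cong xs split ⟩
    Σℚ xs (λ x → 𝟙 (eq₁ x a) * mult eq₂ ys b)
      ≡⟨ Σℚ-*ʳ xs (λ x → 𝟙 (eq₁ x a)) (mult eq₂ ys b) ⟨
    mult eq₁ xs a * mult eq₂ ys b ∎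
    where
    open ≡-Reasoning
    split : ∀ x → Σℚ ys (λ y → 𝟙 (eq₁ x a ∧ eq₂ y b)) ≡ 𝟙 (eq₁ x a) * mult eq₂ ys b
    split x = trans (Σℚ-cong ys (λ y → 𝟙-∧ (eq₁ x a) (eq₂ y b))) (sym (Σℚ-*ˡ ys (λ y → 𝟙 (eq₂ y b)) (𝟙 (eq₁ x a))))

  enumerates-cartesianProduct : {eq₁ : A → A → Bool} {eq₂ : B → B → Bool} {xs : List A} {ys : List B} →
    Enumerates eq₁ xs → Enumerates eq₂ ys → Enumerates (eq₁ ⊗ eq₂) (cartesianProduct xs ys)
  enumerates-cartesianProduct {eq₁ = eq₁} {eq₂} {xs} {ys} once₁ once₂ (a , b) =
    trans (mult-cartesianProduct eq₁ eq₂ xs ys a b) (trans (cong₂ _*_ (once₁ a) (once₂ b)) (*-identityˡ 1ℚ))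

  mult-allFunsIn : ∀ m (_==_ : A → A → Bool) (opts : Fin m → List A) (f : Fin m → A) →
    mult (pointwise _==_) (allFunsIn m opts) f ≡ ∏ m (λ i → mult _==_ (opts i) (f i))
  mult-allFunsIn m _==_ opts f =
    trans (Σℚ-cong (allFunsIn m opts) (λ g → 𝟙-every m (λ i → g i == f i)))
          (Σℚ-allFunsIn-∏ m opts (λ i x → 𝟙 (x == f i)))

  enumerates-allFuns : ∀ m {_==_ : A → A → Bool} {xs : List A} →
    Enumerates _==_ xs → Enumerates (pointwise {m = m} _==_) (allFuns m xs)
  enumerates-allFuns m {_==_} {xs} once f = begin
    mult (pointwise _==_) (allFuns m xs) f           ≡⟨ cong (λ fs → mult (pointwise _==_) fs f) (allFuns≡allFunsIn m xs) ⟩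
    mult (pointwise _==_) (allFunsIn m (λ _ → xs)) f ≡⟨ mult-allFunsIn m _==_ (λ _ → xs) f ⟩
    ∏ m (λ i → mult _==_ xs (f i))                   ≡⟨ ∏-cong m (once ∘ f) ⟩
    ∏ m (λ _ → 1ℚ)                                   ≡⟨ ∏-1 m ⟩
    1ℚ                                               ∎
    where open ≡-Reasoning

  card-allFunsIn : ∀ m (opts : Fin m → List A) →
    Σℚ (allFunsIn m opts) (λ _ → 1ℚ) ≡ ∏ m (λ i → Σℚ (opts i) (λ _ → 1ℚ))
  card-allFunsIn m opts =
    trans (Σℚ-cong (allFunsIn m opts) (λ _ → sym (∏-1 m))) (Σℚ-allFunsIn-∏ m opts (λ _ _ → 1ℚ))

  mult-filterᵇ : (_==_ : A → A → Bool) (p : A → Bool) (xs : List A) (a : A) →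
                 mult _==_ (filterᵇ p xs) a ≤ mult _==_ xs a
  mult-filterᵇ _==_ p xs a =
    ≤-trans (≤-reflexive (Σℚ-filterᵇ p xs (λ x → 𝟙 (x == a)))) (Σℚ-mono xs (λ x → kept (p x) (𝟙-nonNeg (x == a))))
    where
    kept : ∀ b {q} → 0ℚ ≤ q → (if b then q else 0ℚ) ≤ q
    kept true  0≤q = ≤-refl
    kept false 0≤q = 0≤q

  enumerates-allFin : ∀ n → Enumerates (test Fin._≟_) (allFin n)
  enumerates-allFin (suc n) zero = begin
    mult (test Fin._≟_) (allFin (suc n)) zero                ≡⟨ Σℚ-allFin-suc {n} (λ x → 𝟙 (test Fin._≟_ x zero)) ⟩
    1ℚ + Σℚ (allFin n) (λ x → 𝟙 (test Fin._≟_ (suc x) zero)) ≡⟨ cong (1ℚ +_) (Σℚ-0 (allFin n)) ⟩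
    1ℚ + 0ℚ                                                  ≡⟨ +-identityʳ 1ℚ ⟩
    1ℚ                                                       ∎
    where open ≡-Reasoning
  enumerates-allFin (suc n) (suc a) =
    trans (Σℚ-allFin-suc {n} (λ x → 𝟙 (test Fin._≟_ x (suc a)))) (trans (+-identityˡ _) (enumerates-allFin n a))

  enumerates-Bool : Enumerates (test Bool._≟_) (true ∷ false ∷ [])
  enumerates-Bool true  = trans (+-identityʳ _) (+-identityʳ _)
  enumerates-Bool false = trans (+-identityˡ _) (+-identityʳ _)

  enumerates-allLits : ∀ n → Enumerates (test Fin._≟_ ⊗ test Bool._≟_) (allLits n)
  enumerates-allLits n =
    enumerates-cartesianProduct {eq₁ = test Fin._≟_} {test Bool._≟_} {allFin n} {true ∷ false ∷ []}
      (enumerates-allFin n) enumerates-Bool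

  _≟ᶜ_ : ∀ {m k} → DecidableEquality (Choice m k)
  _≟ᶜ_ = Maybe.≡-dec (Product.≡-dec Fin._≟_ Fin._≟_)

  enumerates-allChoices : ∀ m k → Enumerates (test _≟ᶜ_) (allChoices m k)
  enumerates-allChoices m k nothing =
    trans (cong (1ℚ +_) (trans (Σℚ-map just pairs (hits nothing)) (Σℚ-0 pairs))) (+-identityʳ 1ℚ)
    where
    pairs : List (Fin m × Fin k)
    pairs = cartesianProduct (allFin m) (allFin k)
    hits : Choice m k → Choice m k → ℚ
    hits c′ c = 𝟙 (test _≟ᶜ_ c c′)
  enumerates-allChoices m k (just p) = begin
    0ℚ + Σℚ (map just pairs) (hits (just p))             ≡⟨ +-identityˡ _ ⟩
    Σℚ (map just pairs) (hits (just p))                  ≡⟨ Σℚ-map just pairs (hits (just p)) ⟩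
    mult (test (Product.≡-dec Fin._≟_ Fin._≟_)) pairs p  ≡⟨ Σℚ-cong pairs (λ q → cong 𝟙 (test-≡-dec-× Fin._≟_ Fin._≟_ q p)) ⟩
    mult (test Fin._≟_ ⊗ test Fin._≟_) pairs p           ≡⟨ once p ⟩
    1ℚ                                                   ∎
    where
    open ≡-Reasoning
    pairs : List (Fin m × Fin k)
    pairs = cartesianProduct (allFin m) (allFin k)
    hits : Choice m k → Choice m k → ℚ
    hits c′ c = 𝟙 (test _≟ᶜ_ c c′)
    once : Enumerates (test Fin._≟_ ⊗ test Fin._≟_) pairs
    once = enumerates-cartesianProduct {eq₁ = test Fin._≟_} {test Fin._≟_} {allFin m} {allFin k}
             (enumerates-allFin m) (enumerates-allFin k)

  enumerates-allVecs : ∀ t {_≟_ : DecidableEquality A} {xs : List A} →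
    Enumerates (test _≟_) xs → Enumerates (test (Vec.≡-dec _≟_)) (allVecs t xs)
  enumerates-allVecs zero    once [] = +-identityʳ 1ℚ
  enumerates-allVecs {A = A} (suc t) {_≟_} {xs} once (a ∷ as) = begin
    Σℚ (concatMap cons xs) hits                              ≡⟨ Σℚ-concatMap cons xs hits ⟩
    Σℚ xs (λ x → Σℚ (cons x) hits)                           ≡⟨ Σℚ-cong xs split ⟩
    Σℚ xs (λ x → 𝟙 (test _≟_ x a) * mult (test _≟ᵛ_) vs as) ≡⟨ Σℚ-*ʳ xs (λ x → 𝟙 (test _≟_ x a)) _ ⟨
    mult (test _≟_) xs a * mult (test _≟ᵛ_) vs as           ≡⟨ cong₂ _*_ (once a) (enumerates-allVecs t once as) ⟩
    1ℚ * 1ℚ                                                 ≡⟨ *-identityˡ 1ℚ ⟩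
    1ℚ                                                      ∎
    where
    open ≡-Reasoning
    _≟ᵛ_ : ∀ {t} → DecidableEquality (Vec A t)
    _≟ᵛ_ = Vec.≡-dec _≟_
    vs : List (Vec A t)
    vs = allVecs t xs
    cons : A → List (Vec A (suc t))
    cons x = map (x ∷_) vs
    hits : Vec A (suc t) → ℚ
    hits v = 𝟙 (test _≟ᵛ_ v (a ∷ as))
    split : ∀ x → Σℚ (cons x) hits ≡ 𝟙 (test _≟_ x a) * mult (test _≟ᵛ_) vs as
    split x = trans (Σℚ-map (x ∷_) vs hits)
      (trans (Σℚ-cong vs (λ v → 𝟙-∧ (test _≟_ x a) (test _≟ᵛ_ v as)))
             (sym (Σℚ-*ˡ vs (λ v → 𝟙 (test _≟ᵛ_ v as)) (𝟙 (test _≟_ x a)))))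

  -- Each x with positive weight is counted once through φ x ∈ ys, and ψ y ∈ xs counts each y at most once.
  double-counting : {X Y : Set} (_==ˣ_ : X → X → Bool) (_==ʸ_ : Y → Y → Bool) (xs : List X) (ys : List Y)
    (φ : X → Y) (ψ : Y → X) (h : X → ℚ) (w : Y → ℚ) →
    (∀ x → mult _==ˣ_ xs x ≤ 1ℚ) → Enumerates _==ʸ_ ys → (∀ y → 0ℚ ≤ w y) →
    (∀ x → x ∈ xs → 0ℚ < h x → ∀ y → y ==ʸ φ x ≡ true → x ==ˣ ψ y ≡ true × h x ≤ w y) →
    Σℚ xs h ≤ Σℚ ys w
  double-counting _==ˣ_ _==ʸ_ xs ys φ ψ h w xs-once ys-once 0≤w decode = begin
    Σℚ xs h                                          ≡⟨ Σℚ-cong xs through-ys ⟨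
    Σℚ xs (λ x → mult _==ʸ_ ys (φ x) * h x)          ≡⟨ Σℚ-cong xs (λ x → Σℚ-*ʳ ys (λ y → 𝟙 (y ==ʸ φ x)) (h x)) ⟩
    Σℚ xs (λ x → Σℚ ys (λ y → 𝟙 (y ==ʸ φ x) * h x)) ≤⟨ Σℚ-mono-∈ xs (λ x x∈xs → Σℚ-mono ys (termwise x x∈xs)) ⟩
    Σℚ xs (λ x → Σℚ ys (λ y → 𝟙 (x ==ˣ ψ y) * w y)) ≡⟨ Σℚ-swap xs ys (λ x y → 𝟙 (x ==ˣ ψ y) * w y) ⟩
    Σℚ ys (λ y → Σℚ xs (λ x → 𝟙 (x ==ˣ ψ y) * w y)) ≡⟨ Σℚ-cong ys (λ y → Σℚ-*ʳ xs (λ x → 𝟙 (x ==ˣ ψ y)) (w y)) ⟨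
    Σℚ ys (λ y → mult _==ˣ_ xs (ψ y) * w y)          ≤⟨ Σℚ-mono ys at-most-w ⟩
    Σℚ ys w                                          ∎
    where
    open ≤-Reasoning
    through-ys : ∀ x → mult _==ʸ_ ys (φ x) * h x ≡ h x
    through-ys x = trans (cong (_* h x) (ys-once (φ x))) (*-identityˡ (h x))
    at-most-w : ∀ y → mult _==ˣ_ xs (ψ y) * w y ≤ w y
    at-most-w y = ≤-trans (*-monoʳ-≤-nonNeg (w y) {{nonNegative (0≤w y)}} (xs-once (ψ y)))
                          (≤-reflexive (*-identityˡ (w y)))
    termwise : ∀ x → x ∈ xs → ∀ y → 𝟙 (y ==ʸ φ x) * h x ≤ 𝟙 (x ==ˣ ψ y) * w y
    termwise x x∈xs y with 0ℚ <? h x | y ==ʸ φ x in y≈φx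
    ... | no h≯0  | b     = ≤-trans (𝟙*-nonPos b (≮⇒≥ h≯0)) (*-nonNeg (𝟙-nonNeg (x ==ˣ ψ y)) (0≤w y))
    ... | yes 0<h | false = ≤-trans (≤-reflexive (*-zeroˡ (h x))) (*-nonNeg (𝟙-nonNeg (x ==ˣ ψ y)) (0≤w y))
    ... | yes 0<h | true  with decode x x∈xs 0<h y y≈φx
    ...   | x≈ψy , h≤w rewrite x≈ψy = *-monoˡ-≤-nonNeg 1ℚ h≤w

module WalkProperties where

  open import Data.Bool using (Bool; true; false; if_then_else_; not; _∧_; _∨_)
  open import Data.Bool.ListAction using (and; or)
  open import Data.Bool.Properties using (T-≡)
  open import Data.Empty using (⊥-elim)
  open import Data.Fin using (Fin; zero; suc)
  import Data.Fin.Properties as Fin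
  open import Data.Fin.Subset using (Subset; _∪_; ⁅_⁆; _─_; _∈_; _∉_; _⊆_; ⊥)
  open import Data.Fin.Subset.Properties
    using (p⊆p∪q; q⊆p∪q; x∈p∪q⁻; x∈⁅x⁆; x∈⁅y⁆⇒x≡y; ∉⊥; p─q⊆p; x∈p∧x∉q⇒x∈p─q; _∈?_)
  open import Data.List as List using (List; []; _∷_; allFin; foldr)
  open import Data.List.Properties using (map-cong; foldr-cong)
  open import Data.List.Membership.Propositional using () renaming (_∈_ to _∈ˡ_)
  open import Data.List.Membership.Propositional.Properties using (∈-allFin)
  open import Data.List.Relation.Unary.All as All using ()
  open import Data.List.Relation.Unary.All.Properties using (all⁺)
  open import Data.List.Relation.Unary.Any using (here; there)
  open import Data.Maybe using (Maybe; just; nothing; maybe′)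
  open import Data.Nat using (ℕ; zero; suc; _*_; _≤ᵇ_; _<ᵇ_)
  open import Data.Nat.ListAction using (sum)
  open import Data.Product using (_×_; _,_; proj₁; proj₂; ∃; ∃₂)
  import Data.Rational as ℚ
  open import Data.Sum using (_⊎_; inj₁; inj₂)
  open import Data.Sum.Properties using (inj₁-injective)
  open import Data.Vec using (lookup)
  open import Data.Vec.Properties using ([]=⇒lookup; lookup⇒[]=; tabulate-cong)
  open import Function using (_∘_; Equivalence)
  open import Relation.Binary.PropositionalEquality
  open import Relation.Nullary using (yes; no)
  open import Defs

  private variable
    X Y : Set
    n m k : ℕ

  if-elim : (P : X → Set) (b : Bool) {x y : X} →
            (b ≡ true → P x) → (b ≡ false → P y) → P (if b then x else y)
  if-elim P true  onTrue onFalse = onTrue refl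
  if-elim P false onTrue onFalse = onFalse refl

  if-elim₂ : (R : X → Y → Set) {b b′ : Bool} → b ≡ b′ → {x y : X} {x′ y′ : Y} →
             (b ≡ true → R x x′) → (b ≡ false → R y y′) → R (if b then x else y) (if b′ then x′ else y′)
  if-elim₂ R {true}  refl onTrue onFalse = onTrue refl
  if-elim₂ R {false} refl onTrue onFalse = onFalse refl

  maybe′-elim : (P : Y → Set) {f : X → Y} {d : Y} (r : Maybe X) →
                P d → (∀ a → r ≡ just a → P (f a)) → P (maybe′ f d r)
  maybe′-elim P nothing  onNothing onJust = onNothing
  maybe′-elim P (just a) onNothing onJust = onJust a refl

  ∈⇒lookup : {x : Fin n} {p : Subset n} → x ∈ p → lookup p x ≡ true
  ∈⇒lookup = []=⇒lookup

  ∉⇒lookup : {x : Fin n} {p : Subset n} → x ∉ p → lookup p x ≡ false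
  ∉⇒lookup {x = x} {p} x∉p with lookup p x in eq
  ... | true  = ⊥-elim (x∉p (lookup⇒[]= x p eq))
  ... | false = refl

  revealed : State n m k → Subset n
  revealed s = State.A s ∪ State.N s

  module _ (Φ : Formula n m k) where
    open Walk Φ
    open State

    Occurs : Fin n → Set
    Occurs v = ∃₂ λ i j → var i j ≡ v

    shown : Subset n → Fin m → Fin k → PiEntry n
    shown S i j = if lookup S (var i j) then inj₁ (Φ i j) else inj₂ (sgn i j)

    shown-lookup : ∀ {S i j b} → lookup S (var i j) ≡ b →
                   shown S i j ≡ (if b then inj₁ (Φ i j) else inj₂ (sgn i j))
    shown-lookup {i = i} {j} = cong (λ b → if b then inj₁ (Φ i j) else inj₂ (sgn i j))

    -- Verbatim the unsatisfied branch of step, so that step-just-elim holds definitionally.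
    move : State n m k → Fin m → Fin k → State n m k
    move s i j =
      let y   = var i j
          ZN  = loop m (A s) y (Z s) (N s)
          Z'  = proj₁ ZN
          N'  = proj₂ ZN
          A'  = (A s ∪ ⁅ y ⁆) ─ N'
      in record
        { σ = flip (σ s) y ; A = A' ; N = N' ; Z = Z' ; last = just (i , j)
        ; π = λ i' j' → if lookup (A' ∪ N') (var i' j') then inj₁ (Φ i' j') else inj₂ (sgn i' j') }

    step-just-elim : (P : State n m k → Set) (s : State n m k) (i : Fin m) (j : Fin k) →
      (formSat (σ s) ≡ true → P s) → (formSat (σ s) ≡ false → P (move s i j)) → P (step s (just (i , j)))
    step-just-elim P s i j = if-elim P (formSat (σ s))

    loop-invariant : (P : Subset m × Subset n → Set) →
                     (∀ {Z N} i → P (Z , N) → P (Z ∪ ⁅ i ⁆ , N ∪ varsOf i)) →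
                     ∀ f S y Z N → P (Z , N) → P (loop f S y Z N)
    loop-invariant P preserved zero    S y Z N holds = holds
    loop-invariant P preserved (suc f) S y Z N holds = maybe′-elim P (firstFin (cand S y Z N)) holds
      (λ i _ → loop-invariant P preserved f S y (Z ∪ ⁅ i ⁆) (N ∪ varsOf i) (preserved i holds))

    foldr-vars : Fin m → List (Fin k) → Subset n
    foldr-vars i = foldr (λ j S → ⁅ var i j ⁆ ∪ S) ⊥

    varsOf-occurs : ∀ i {v} → v ∈ varsOf i → ∃ λ j → var i j ≡ v
    varsOf-occurs i = go (allFin k)
      where
      go : ∀ js {v} → v ∈ foldr-vars i js → ∃ λ j → var i j ≡ v
      go []       v∈ = ⊥-elim (∉⊥ v∈)
      go (j ∷ js) v∈ with x∈p∪q⁻ ⁅ var i j ⁆ (foldr-vars i js) v∈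
      ... | inj₁ v∈⁅y⁆ = j , sym (x∈⁅y⁆⇒x≡y (var i j) v∈⁅y⁆)
      ... | inj₂ v∈js  = go js v∈js

    var∈varsOf : ∀ i j → var i j ∈ varsOf i
    var∈varsOf i j = go (allFin k) (∈-allFin j)
      where
      go : ∀ js → j ∈ˡ js → var i j ∈ foldr-vars i js
      go (j ∷ js) (here refl) = p⊆p∪q (foldr-vars i js) (x∈⁅x⁆ (var i j))
      go (j′ ∷ js) (there j∈) = q⊆p∪q ⁅ var i j′ ⁆ (foldr-vars i js) (go js j∈)

    loop-grows : ∀ f S y Z N → N ⊆ proj₂ (loop f S y Z N)
    loop-grows f S y Z N = loop-invariant (λ ZN → N ⊆ proj₂ ZN)
      (λ {_} {N′} i N⊆N′ → p⊆p∪q (varsOf i) ∘ N⊆N′) f S y Z N (λ v∈ → v∈)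

    loop-occurs : ∀ f S y Z N {v} → v ∈ proj₂ (loop f S y Z N) → v ∈ N ⊎ Occurs v
    loop-occurs f S y Z N =
      loop-invariant (λ ZN → ∀ {v} → v ∈ proj₂ ZN → v ∈ N ⊎ Occurs v) (λ i → grown i) f S y Z N inj₁
      where
      grown : ∀ {N′} i → (∀ {v} → v ∈ N′ → v ∈ N ⊎ Occurs v) →
              ∀ {v} → v ∈ N′ ∪ varsOf i → v ∈ N ⊎ Occurs v
      grown {N′ = N′} i old v∈ with x∈p∪q⁻ N′ (varsOf i) v∈
      ... | inj₁ v∈N′ = old v∈N′
      ... | inj₂ v∈i  = inj₂ (i , varsOf-occurs i v∈i)

    module _ (s : State n m k) (i : Fin m) (j : Fin k) where
      private
        y : Fin n
        y = var i j
        N′ : Subset n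
        N′ = proj₂ (loop m (A s) y (Z s) (N s))

      revealed-move⁺ : A s ∪ ⁅ y ⁆ ⊆ revealed (move s i j)
      revealed-move⁺ {v} v∈ with v ∈? N′
      ... | yes v∈N′ = q⊆p∪q _ N′ v∈N′
      ... | no  v∉N′ = p⊆p∪q N′ (x∈p∧x∉q⇒x∈p─q v∈ v∉N′)

      loop-⊆-revealed-move : N′ ⊆ revealed (move s i j)
      loop-⊆-revealed-move = q⊆p∪q _ N′

      revealed-move⁻ : ∀ {v} → v ∈ revealed (move s i j) → v ∈ A s ∪ ⁅ y ⁆ ⊎ v ∈ N′
      revealed-move⁻ v∈ with x∈p∪q⁻ ((A s ∪ ⁅ y ⁆) ─ N′) N′ v∈
      ... | inj₁ v∈A─N′ = inj₁ (p─q⊆p _ N′ v∈A─N′)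
      ... | inj₂ v∈N′   = inj₂ v∈N′

      var∈revealed-move : y ∈ revealed (move s i j)
      var∈revealed-move = revealed-move⁺ (q⊆p∪q (A s) ⁅ y ⁆ (x∈⁅x⁆ y))

      revealed-mono-move : revealed s ⊆ revealed (move s i j)
      revealed-mono-move v∈ with x∈p∪q⁻ (A s) (N s) v∈
      ... | inj₁ v∈A = revealed-move⁺ (p⊆p∪q ⁅ y ⁆ v∈A)
      ... | inj₂ v∈N = loop-⊆-revealed-move (loop-grows m (A s) y (Z s) (N s) v∈N)

    revealed-mono-step : ∀ s c → revealed s ⊆ revealed (step s c)
    revealed-mono-step s nothing        v∈ = v∈
    revealed-mono-step s (just (i , j)) v∈ =
      step-just-elim (λ s′ → _ ∈ revealed s′) s i j (λ _ → v∈) (λ _ → revealed-mono-move s i j v∈)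

    revealed-mono-run : ∀ s cs → revealed s ⊆ revealed (runFrom s cs)
    revealed-mono-run s []       = λ v∈ → v∈
    revealed-mono-run s (c ∷ cs) = revealed-mono-run (step s c) cs ∘ revealed-mono-step s c

    record Invariant (s : State n m k) : Set where
      field
        untouched       : ∀ {v} → v ∉ revealed s → σ s v ≡ true
        π≗shown         : ∀ i j → π s i j ≡ shown (revealed s) i j
        revealed-occurs : ∀ {v} → v ∈ revealed s → Occurs v

    invariant-initial : Invariant initial
    invariant-initial = record
      { untouched       = λ _ → refl
      ; π≗shown         = λ i j → sym (shown-lookup {S = revealed initial} (∉⇒lookup nothing-revealed))
      ; revealed-occurs = ⊥-elim ∘ nothing-revealed
      }
      where
      nothing-revealed : ∀ {v} → v ∉ revealed initial
      nothing-revealed v∈ with x∈p∪q⁻ ⊥ ⊥ v∈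
      ... | inj₁ v∈⊥ = ∉⊥ v∈⊥
      ... | inj₂ v∈⊥ = ∉⊥ v∈⊥

    invariant-move : ∀ s i j → Invariant s → Invariant (move s i j)
    invariant-move s i j inv = record
      { untouched       = untouched′
      ; π≗shown         = λ _ _ → refl
      ; revealed-occurs = occurs′
      }
      where
      open Invariant inv
      y : Fin n
      y = var i j
      untouched′ : ∀ {v} → v ∉ revealed (move s i j) → flip (σ s) y v ≡ true
      untouched′ {v} v∉ with v Fin.≟ y
      ... | yes refl = ⊥-elim (v∉ (var∈revealed-move s i j))
      ... | no  _    = untouched (v∉ ∘ revealed-mono-move s i j)
      occurs′ : ∀ {v} → v ∈ revealed (move s i j) → Occurs v
      occurs′ v∈ with revealed-move⁻ s i j v∈
      ... | inj₂ v∈N′ with loop-occurs m (A s) y (Z s) (N s) v∈N′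
      ...   | inj₁ v∈N    = revealed-occurs (q⊆p∪q (A s) (N s) v∈N)
      ...   | inj₂ occurs = occurs
      occurs′ v∈ | inj₁ v∈A∪y with x∈p∪q⁻ (A s) ⁅ y ⁆ v∈A∪y
      ...   | inj₁ v∈A = revealed-occurs (p⊆p∪q (N s) v∈A)
      ...   | inj₂ v∈y = i , j , sym (x∈⁅y⁆⇒x≡y y v∈y)

    invariant-step : ∀ s c → Invariant s → Invariant (step s c)
    invariant-step s nothing        inv = inv
    invariant-step s (just (i , j)) inv =
      step-just-elim Invariant s i j (λ _ → inv) (λ _ → invariant-move s i j inv)

    invariant-run : ∀ s cs → Invariant s → Invariant (runFrom s cs)
    invariant-run s []       inv = inv
    invariant-run s (c ∷ cs) inv = invariant-run (step s c) cs (invariant-step s c inv)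

  allF-cong : {p q : Fin k → Bool} → (∀ j → p j ≡ q j) → allF p ≡ allF q
  allF-cong {k = k} p≗q = cong and (map-cong p≗q (allFin k))

  anyF-cong : {p q : Fin k → Bool} → (∀ j → p j ≡ q j) → anyF p ≡ anyF q
  anyF-cong {k = k} p≗q = cong or (map-cong p≗q (allFin k))

  countFin-cong : {p q : Fin k → Bool} → (∀ j → p j ≡ q j) → countFin p ≡ countFin q
  countFin-cong {k = k} p≗q = cong sum (map-cong (λ j → cong (λ b → if b then 1 else 0) (p≗q j)) (allFin k))

  allF⁻ : {p : Fin k → Bool} → allF p ≡ true → ∀ j → p j ≡ true
  allF⁻ {k = k} {p} holds j =
    Equivalence.to T-≡ (All.lookup (all⁺ p (allFin k) (Equivalence.from T-≡ holds)) (∈-allFin j))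

  firstFin-cong : {p q : Fin m → Bool} → (∀ i → p i ≡ q i) → firstFin p ≡ firstFin q
  firstFin-cong {m = zero}  p≗q = refl
  firstFin-cong {m = suc m} {p} {q} p≗q
    rewrite p≗q zero | firstFin-cong {p = p ∘ suc} {q = q ∘ suc} (p≗q ∘ suc) = refl

  Agree : Subset n → Formula n m k → Formula n m k → Set
  Agree U Φ Φ′ = ∀ i j → proj₂ (Φ i j) ≡ proj₂ (Φ′ i j) ×
                         (proj₁ (Φ i j) ≡ proj₁ (Φ′ i j) ⊎ (proj₁ (Φ i j) ∉ U × proj₁ (Φ′ i j) ∉ U))

  record _≈ₛ_ (s s′ : State n m k) : Set where
    open State
    field
      σ≡    : σ s ≡ σ s′
      A≡    : A s ≡ A s′
      N≡    : N s ≡ N s′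
      Z≡    : Z s ≡ Z s′
      last≡ : last s ≡ last s′
      π≗    : ∀ i j → π s i j ≡ π s′ i j

  module Locality {U : Subset n} (Φ Φ′ : Formula n m k) (agree : Agree U Φ Φ′) where
    module W  = Walk Φ
    module W′ = Walk Φ′
    open State

    var-agree : ∀ i j → W.var i j ∈ U → W.var i j ≡ W′.var i j
    var-agree i j var∈U with proj₂ (agree i j)
    ... | inj₁ same     = same
    ... | inj₂ (∉U , _) = ⊥-elim (∉U var∈U)

    lookup-agree : ∀ {S} → S ⊆ U → ∀ i j → lookup S (W.var i j) ≡ lookup S (W′.var i j)
    lookup-agree {S} S⊆U i j with proj₂ (agree i j)
    ... | inj₁ same        = cong (lookup S) same
    ... | inj₂ (∉U , ∉U′) = trans (∉⇒lookup (∉U ∘ S⊆U)) (sym (∉⇒lookup (∉U′ ∘ S⊆U)))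

    module _ (σ₀ : Fin n → Bool) (untouched : ∀ {v} → v ∉ U → σ₀ v ≡ true) where
      litSat-agree : ∀ i j → W.litSat σ₀ (Φ i j) ≡ W′.litSat σ₀ (Φ′ i j)
      litSat-agree i j with proj₂ (agree i j)
      ... | inj₁ same        = cong (W.litSat σ₀) (cong₂ _,_ same (proj₁ (agree i j)))
      ... | inj₂ (∉U , ∉U′) = cong₂ (λ b x → if b then x else not x)
                                       (proj₁ (agree i j)) (trans (untouched ∉U) (sym (untouched ∉U′)))

      clauseSat-agree : ∀ i → W.clauseSat σ₀ i ≡ W′.clauseSat σ₀ i
      clauseSat-agree i = anyF-cong (litSat-agree i)

      formSat-agree : W.formSat σ₀ ≡ W′.formSat σ₀
      formSat-agree = allF-cong clauseSat-agree

      unsat-agree : W.unsat σ₀ ≡ W′.unsat σ₀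
      unsat-agree = countFin-cong (cong not ∘ clauseSat-agree)

    untouched-outside : ∀ {s} → Invariant Φ s → revealed s ⊆ U → ∀ {v} → v ∉ U → σ s v ≡ true
    untouched-outside inv s⊆U v∉U = Invariant.untouched inv (v∉U ∘ s⊆U)

    stepW-agree : ∀ {s s′} → Invariant Φ s → revealed s ⊆ U → σ s ≡ σ s′ →
                  ∀ c → W.stepW s c ≡ W′.stepW s′ c
    stepW-agree {s} invariant s⊆U refl nothing
      rewrite formSat-agree (σ s) (untouched-outside invariant s⊆U) = refl
    stepW-agree {s} invariant s⊆U refl (just (i , j))
      rewrite formSat-agree (σ s) (untouched-outside invariant s⊆U)
            | clauseSat-agree (σ s) (untouched-outside invariant s⊆U) i
            | unsat-agree (σ s) (untouched-outside invariant s⊆U) = refl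

    cand-agree : ∀ S y Z N → S ∪ ⁅ y ⁆ ⊆ U → N ⊆ U → ∀ i → W.cand S y Z N i ≡ W′.cand S y Z N i
    cand-agree S y Z N S∪y⊆U N⊆U i =
      cong₂ (λ a b → not (lookup Z i) ∧ a ∧ b)
        (allF-cong (λ j → cong₂ (λ a b → not a ∨ b) (proj₁ (agree i j)) (lookup-agree all⊆U i j)))
        (cong₂ _∨_ (cong (λ c → (49 * k) ≤ᵇ (100 * c)) (countFin-cong (lookup-agree S∪y⊆U i)))
                   (cong (λ c → k <ᵇ (c * c)) (countFin-cong (lookup-agree N⊆U i))))
      where
      all⊆U : S ∪ N ∪ ⁅ y ⁆ ⊆ U
      all⊆U v∈ with x∈p∪q⁻ S (N ∪ ⁅ y ⁆) v∈
      ... | inj₁ v∈S   = S∪y⊆U (p⊆p∪q ⁅ y ⁆ v∈S)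
      ... | inj₂ v∈N∪y with x∈p∪q⁻ N ⁅ y ⁆ v∈N∪y
      ...   | inj₁ v∈N = N⊆U v∈N
      ...   | inj₂ v∈y = S∪y⊆U (q⊆p∪q S ⁅ y ⁆ v∈y)

    varsOf-agree : ∀ i → (∀ j → W.var i j ≡ W′.var i j) → W.varsOf i ≡ W′.varsOf i
    varsOf-agree i var≗ = foldr-cong (λ j S → cong (λ v → ⁅ v ⁆ ∪ S) (var≗ j)) refl (allFin k)

    loop-agree : ∀ f S y Z N → S ∪ ⁅ y ⁆ ⊆ U → proj₂ (W.loop f S y Z N) ⊆ U →
                 W.loop f S y Z N ≡ W′.loop f S y Z N
    loop-agree zero    S y Z N _ _ = refl
    loop-agree (suc f) S y Z N S∪y⊆U out⊆U =
      trans (continue (firstFin (W.cand S y Z N)) out⊆U)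
            (cong (maybe′ next′ (Z , N)) (firstFin-cong (cand-agree S y Z N S∪y⊆U N⊆U)))
      where
      N⊆U : N ⊆ U
      N⊆U = out⊆U ∘ loop-grows Φ (suc f) S y Z N
      next next′ : Fin m → Subset m × Subset n
      next  i = W.loop f S y (Z ∪ ⁅ i ⁆) (N ∪ W.varsOf i)
      next′ i = W′.loop f S y (Z ∪ ⁅ i ⁆) (N ∪ W′.varsOf i)
      continue : ∀ r → proj₂ (maybe′ next (Z , N) r) ⊆ U → maybe′ next (Z , N) r ≡ maybe′ next′ (Z , N) r
      continue nothing  _       = refl
      continue (just i) next⊆U  =
        trans (loop-agree f S y (Z ∪ ⁅ i ⁆) (N ∪ W.varsOf i) S∪y⊆U next⊆U)
              (cong (λ V → W′.loop f S y (Z ∪ ⁅ i ⁆) (N ∪ V)) (varsOf-agree i (λ j → var-agree i j (var∈U j))))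
        where
        var∈U : ∀ j → W.var i j ∈ U
        var∈U j = next⊆U (loop-grows Φ f S y (Z ∪ ⁅ i ⁆) (N ∪ W.varsOf i)
                                     (q⊆p∪q N (W.varsOf i) (var∈varsOf Φ i j)))

    shown-agree : ∀ {S} → S ⊆ U → ∀ i j → shown Φ S i j ≡ shown Φ′ S i j
    shown-agree {S} S⊆U i j with proj₂ (agree i j)
    ... | inj₁ same =
      cong (λ l → if lookup S (proj₁ l) then inj₁ l else inj₂ (proj₂ l)) (cong₂ _,_ same (proj₁ (agree i j)))
    ... | inj₂ (∉U , ∉U′) = begin
      shown Φ S i j         ≡⟨ shown-lookup Φ {S = S} (∉⇒lookup (∉U ∘ S⊆U)) ⟩
      inj₂ (proj₂ (Φ i j))  ≡⟨ cong inj₂ (proj₁ (agree i j)) ⟩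
      inj₂ (proj₂ (Φ′ i j)) ≡⟨ shown-lookup Φ′ {S = S} (∉⇒lookup (∉U′ ∘ S⊆U)) ⟨
      shown Φ′ S i j        ∎
      where open ≡-Reasoning

    move-agree : ∀ {s s′} i j → s ≈ₛ s′ → revealed (move Φ s i j) ⊆ U → move Φ s i j ≈ₛ move Φ′ s′ i j
    move-agree {s} {record {}} i j record { σ≡ = refl ; A≡ = refl ; N≡ = refl ; Z≡ = refl } moved⊆U = record
      { σ≡    = cong (W.flip (σ s)) y≡
      ; A≡    = A≡
      ; N≡    = N≡
      ; Z≡    = cong proj₁ loop≡
      ; last≡ = refl
      ; π≗    = λ i′ j′ → trans (shown-agree moved⊆U i′ j′) (cong (λ S → shown Φ′ S i′ j′) (cong₂ _∪_ A≡ N≡))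
      }
      where
      y≡ : W.var i j ≡ W′.var i j
      y≡ = var-agree i j (moved⊆U (var∈revealed-move Φ s i j))
      S∪y⊆U : A s ∪ ⁅ W.var i j ⁆ ⊆ U
      S∪y⊆U = moved⊆U ∘ revealed-move⁺ Φ s i j
      loop≡ : W.loop m (A s) (W.var i j) (Z s) (N s) ≡ W′.loop m (A s) (W′.var i j) (Z s) (N s)
      loop≡ = trans (loop-agree m (A s) (W.var i j) (Z s) (N s) S∪y⊆U (moved⊆U ∘ loop-⊆-revealed-move Φ s i j))
                    (cong (λ y → W′.loop m (A s) y (Z s) (N s)) y≡)
      N≡ : N (move Φ s i j) ≡ N (move Φ′ s i j)
      N≡ = cong proj₂ loop≡
      A≡ : A (move Φ s i j) ≡ A (move Φ′ s i j)
      A≡ = cong₂ (λ y N′ → (A s ∪ ⁅ y ⁆) ─ N′) y≡ N≡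

    formSat-agree-at : ∀ {s s′} → Invariant Φ s → s ≈ₛ s′ → revealed s ⊆ U →
                       W.formSat (σ s) ≡ W′.formSat (σ s′)
    formSat-agree-at {s} invariant s≈s′ s⊆U =
      trans (formSat-agree (σ s) (untouched-outside invariant s⊆U)) (cong W′.formSat (_≈ₛ_.σ≡ s≈s′))

    step-agree : ∀ {s s′} c → Invariant Φ s → s ≈ₛ s′ → revealed (W.step s c) ⊆ U →
                 W.step s c ≈ₛ W′.step s′ c
    step-agree nothing _ s≈s′ _ = s≈s′
    step-agree {s} (just (i , j)) invariant s≈s′ stepped⊆U =
      if-elim₂ _≈ₛ_ (formSat-agree-at invariant s≈s′ s⊆U) (λ _ → s≈s′)
        (λ unsat → move-agree i j s≈s′
                     (subst (λ b → revealed (if b then s else move Φ s i j) ⊆ U) unsat stepped⊆U))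
      where
      s⊆U : revealed s ⊆ U
      s⊆U = stepped⊆U ∘ revealed-mono-step Φ s (just (i , j))

    last-step-agree : ∀ {s s′} c → Invariant Φ s → s ≈ₛ s′ → revealed s ⊆ U →
                      last (W.step s c) ≡ last (W′.step s′ c)
    last-step-agree nothing _ s≈s′ _ = _≈ₛ_.last≡ s≈s′
    last-step-agree (just (i , j)) invariant s≈s′ s⊆U =
      if-elim₂ (λ t t′ → last t ≡ last t′) (formSat-agree-at invariant s≈s′ s⊆U)
               (λ _ → _≈ₛ_.last≡ s≈s′) (λ _ → refl)

    obs-agree : ∀ {s s′} → s ≈ₛ s′ → W.obs s ≡ W′.obs s′
    obs-agree s≈s′ = cong₂ _,_ last≡ (tabulate-cong (λ i → tabulate-cong (π≗ i)))
      where open _≈ₛ_ s≈s′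

    record RunsAgree (s s′ : State n m k) (cs : List (Choice m k)) : Set where
      field
        final≈  : W.runFrom s cs ≈ₛ W′.runFrom s′ cs
        trace≡  : List.map W.obs (W.traceFrom s cs) ≡ List.map W′.obs (W′.traceFrom s′ cs)
        weight≡ : W.weightFrom s cs ≡ W′.weightFrom s′ cs

    run-agree : ∀ cs {s s′} → Invariant Φ s → s ≈ₛ s′ → revealed (W.runFrom s cs) ⊆ U → RunsAgree s s′ cs
    run-agree [] _ s≈s′ _ = record { final≈ = s≈s′ ; trace≡ = cong (_∷ []) (obs-agree s≈s′) ; weight≡ = refl }
    run-agree (c ∷ cs) {s} invariant s≈s′ ran⊆U = record
      { final≈  = final≈
      ; trace≡  = cong₂ _∷_ (obs-agree s≈s′) trace≡
      ; weight≡ = cong₂ ℚ._*_ (stepW-agree invariant s⊆U (_≈ₛ_.σ≡ s≈s′) c) weight≡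
      }
      where
      stepped⊆U : revealed (W.step s c) ⊆ U
      stepped⊆U = ran⊆U ∘ revealed-mono-run Φ (W.step s c) cs
      s⊆U : revealed s ⊆ U
      s⊆U = stepped⊆U ∘ revealed-mono-step Φ s c
      open RunsAgree (run-agree cs (invariant-step Φ s c invariant)
                                (step-agree c invariant s≈s′ stepped⊆U) ran⊆U)

  revealed-⊆-by-π : ∀ {Φ Φ′ : Formula n m k} {s s′} → Invariant Φ s → Invariant Φ′ s′ →
                    (∀ i j → State.π s i j ≡ State.π s′ i j) → revealed s ⊆ revealed s′
  revealed-⊆-by-π {Φ = Φ} {Φ′} {s} {s′} inv inv′ π≗ v∈ with Invariant.revealed-occurs inv v∈
  ... | i , j , refl = shown-in (lookup (revealed s′) (proj₁ (Φ′ i j))) refl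
    where
    entry≡ : ∀ {b} → lookup (revealed s′) (proj₁ (Φ′ i j)) ≡ b →
             (if b then inj₁ (Φ′ i j) else inj₂ (proj₂ (Φ′ i j))) ≡ inj₁ (Φ i j)
    entry≡ {b} shown′ = begin
      (if b then inj₁ (Φ′ i j) else inj₂ (proj₂ (Φ′ i j))) ≡⟨ shown-lookup Φ′ {S = revealed s′} shown′ ⟨
      shown Φ′ (revealed s′) i j                          ≡⟨ Invariant.π≗shown inv′ i j ⟨
      State.π s′ i j                                      ≡⟨ π≗ i j ⟨
      State.π s i j                                       ≡⟨ Invariant.π≗shown inv i j ⟩
      shown Φ (revealed s) i j                            ≡⟨ shown-lookup Φ {S = revealed s} (∈⇒lookup v∈) ⟩
      inj₁ (Φ i j)                                        ∎
      where open ≡-Reasoning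
    shown-in : ∀ b → lookup (revealed s′) (proj₁ (Φ′ i j)) ≡ b → proj₁ (Φ i j) ∈ revealed s′
    shown-in true  shown′ = subst (_∈ revealed s′) (cong proj₁ (inj₁-injective (entry≡ shown′)))
                                  (lookup⇒[]= _ (revealed s′) shown′)
    shown-in false shown′ with () ← entry≡ shown′

module Outcomes where

  open import Data.Bool using (Bool; true; false; if_then_else_; not; _∧_; _∨_)
  open import Data.Bool.Properties using (∧-conicalˡ; ∧-conicalʳ)
  import Data.Bool.Properties as Bool
  open import Data.Fin using (Fin)
  import Data.Fin.Properties as Fin
  open import Data.Fin.Subset using (_∉_)
  open import Data.Fin.Subset.Properties using (⊆-antisym)
  open import Data.List as List using (List; []; _∷_; _++_)
  open import Data.Maybe using (just; nothing)
  import Data.Maybe.Properties as Maybe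
  open import Data.Nat using (ℕ; zero; suc; _*_; _^_)
  open import Data.Product using (_,_; proj₁; proj₂)
  open import Data.Rational using (0ℚ; _≤_)
  import Data.Rational as ℚ
  open import Data.Rational.Properties using (≤-refl; nonNegative⁻¹; normalize-nonNeg; *-assoc; *-identityˡ; *-identityʳ)
  open import Data.Vec as Vec using (Vec; []; _∷_; lookup)
  import Data.Vec.Properties as Vec
  open import Function using (case_of_)
  open import Relation.Binary.PropositionalEquality
  open import Relation.Nullary.Decidable using (⌊_⌋)
  open import Defs
  open Sums
  open Counting
  open WalkProperties

  private variable
    X : Set
    n m k t : ℕ

  lastEntry : Vec X (suc t) → X
  lastEntry (c ∷ [])     = c
  lastEntry (c ∷ d ∷ cs) = lastEntry (d ∷ cs)

  prefix : Vec X (suc t) → List X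
  prefix {t = t} cs = List.take t (Vec.toList cs)

  toList-prefix : (cs : Vec X (suc t)) → Vec.toList cs ≡ prefix cs ++ lastEntry cs ∷ []
  toList-prefix {t = zero}  (c ∷ [])     = refl
  toList-prefix {t = suc t} (c ∷ d ∷ cs) = cong (c ∷_) (toList-prefix (d ∷ cs))

  take-toList : (cs : Vec X t) → List.take t (Vec.toList cs) ≡ Vec.toList cs
  take-toList []       = refl
  take-toList (c ∷ cs) = cong (c ∷_) (take-toList cs)

  module _ (Φ : Formula n m k) where
    open Walk Φ

    runFrom-++ : ∀ s xs ys → runFrom s (xs ++ ys) ≡ runFrom (runFrom s xs) ys
    runFrom-++ s []       ys = refl
    runFrom-++ s (x ∷ xs) ys = runFrom-++ (step s x) xs ys

    weightFrom-∷ʳ : ∀ s xs c → weightFrom s (xs ++ c ∷ []) ≡ weightFrom s xs ℚ.* stepW (runFrom s xs) c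
    weightFrom-∷ʳ s []       c = trans (*-identityʳ (stepW s c)) (sym (*-identityˡ (stepW s c)))
    weightFrom-∷ʳ s (x ∷ xs) c =
      trans (cong (stepW s x ℚ.*_) (weightFrom-∷ʳ (step s x) xs c)) (sym (*-assoc (stepW s x) _ _))

    last-trace : ∀ s cs → List.last (List.map obs (traceFrom s cs)) ≡ just (obs (runFrom s cs))
    last-trace s []            = refl
    last-trace s (c ∷ [])      = refl
    last-trace s (c ∷ c′ ∷ cs) = last-trace (step s c) (c′ ∷ cs)

  stateAt-suc : (ω : Ω n m k (suc t)) →
                stateAt (suc t) ω ≡ Walk.step (proj₁ ω) (stateAt t ω) (lastEntry (proj₂ ω))
  stateAt-suc {t = t} (Φ , cs) =
    trans (cong (Walk.runFrom Φ (Walk.initial Φ)) (trans (take-toList cs) (toList-prefix cs)))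
          (runFrom-++ Φ (Walk.initial Φ) (prefix cs) (lastEntry cs ∷ []))

  weight-suc : (ω : Ω n m k (suc t)) → weight ω ≡
    inv ((2 * n) ^ (k * m)) ℚ.* (Walk.weightFrom (proj₁ ω) (Walk.initial (proj₁ ω)) (prefix (proj₂ ω))
                                  ℚ.* Walk.stepW (proj₁ ω) (stateAt t ω) (lastEntry (proj₂ ω)))
  weight-suc {n = n} {m} {k} (Φ , cs) = cong (inv ((2 * n) ^ (k * m)) ℚ.*_)
    (trans (cong (Walk.weightFrom Φ (Walk.initial Φ)) (toList-prefix cs))
           (weightFrom-∷ʳ Φ (Walk.initial Φ) (prefix cs) (lastEntry cs)))

  history-last : ∀ r (ω : Ω n m k t) → List.last (history r ω) ≡ just (Walk.obs (proj₁ ω) (stateAt r ω))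
  history-last r (Φ , cs) = last-trace Φ (Walk.initial Φ) (List.take r (Vec.toList cs))

  invariant-stateAt : ∀ r (ω : Ω n m k t) → Invariant (proj₁ ω) (stateAt r ω)
  invariant-stateAt r (Φ , cs) =
    invariant-run Φ (Walk.initial Φ) (List.take r (Vec.toList cs)) (invariant-initial Φ)

  sameHist-π : ∀ r (ω ω′ : Ω n m k t) → sameHist r ω ω′ ≡ true →
               ∀ i j → State.π (stateAt r ω′) i j ≡ State.π (stateAt r ω) i j
  sameHist-π {n = n} {m} {k} r ω ω′ same i j = begin
    State.π s′ i j                                       ≡⟨ sym (π-in-obs (proj₁ ω′) s′) ⟩
    lookup (lookup (proj₂ (Walk.obs (proj₁ ω′) s′)) i) j ≡⟨ cong (λ o → lookup (lookup (proj₂ o) i) j) obs≡ ⟩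
    lookup (lookup (proj₂ (Walk.obs (proj₁ ω) s)) i) j   ≡⟨ π-in-obs (proj₁ ω) s ⟩
    State.π s i j                                        ∎
    where
    open ≡-Reasoning
    s s′ : State n m k
    s  = stateAt r ω
    s′ = stateAt r ω′
    π-in-obs : (Φ : Formula n m k) (s : State n m k) → lookup (lookup (proj₂ (Walk.obs Φ s)) i) j ≡ State.π s i j
    π-in-obs Φ s = trans (cong (λ row → lookup row j) (Vec.lookup∘tabulate _ i)) (Vec.lookup∘tabulate _ j)
    obs≡ : Walk.obs (proj₁ ω′) s′ ≡ Walk.obs (proj₁ ω) s
    obs≡ = Maybe.just-injective (begin
      just (Walk.obs (proj₁ ω′) s′) ≡⟨ history-last r ω′ ⟨
      List.last (history r ω′)      ≡⟨ cong List.last (⌊⌋-true⁻ (history r ω′ ≟Hist history r ω) same) ⟩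
      List.last (history r ω)       ≡⟨ history-last r ω ⟩
      just (Walk.obs (proj₁ ω) s)   ∎)

  sameHist-revealed : ∀ r (ω ω′ : Ω n m k t) → sameHist r ω ω′ ≡ true →
                      revealed (stateAt r ω′) ≡ revealed (stateAt r ω)
  sameHist-revealed r ω ω′ same = ⊆-antisym
    (revealed-⊆-by-π (invariant-stateAt r ω′) (invariant-stateAt r ω) π≗)
    (revealed-⊆-by-π (invariant-stateAt r ω) (invariant-stateAt r ω′) (λ i j → sym (π≗ i j)))
    where
    π≗ : ∀ i j → State.π (stateAt r ω′) i j ≡ State.π (stateAt r ω) i j
    π≗ = sameHist-π r ω ω′ same

  _==ᴸ_ : Lit n → Lit n → Bool
  _==ᴸ_ = test Fin._≟_ ⊗ test Bool._≟_

  ==ᴸ-refl : (l : Lit n) → l ==ᴸ l ≡ true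
  ==ᴸ-refl (x , b) = cong₂ _∧_ (test-refl Fin._≟_ x) (test-refl Bool._≟_ b)

  ==ᴸ-sound : {l l′ : Lit n} → l ==ᴸ l′ ≡ true → l ≡ l′
  ==ᴸ-sound {l = x , b} {x′ , b′} holds =
    cong₂ _,_ (test-sound Fin._≟_ (∧-conicalˡ _ _ holds)) (test-sound Bool._≟_ (∧-conicalʳ _ _ holds))

  _==ᶠ_ : Formula n m k → Formula n m k → Bool
  _==ᶠ_ = pointwise (pointwise _==ᴸ_)

  _==Ω_ : Ω n m k t → Ω n m k t → Bool
  _==Ω_ = _==ᶠ_ ⊗ test (Vec.≡-dec _≟ᶜ_)

  enumerates-allΩ : ∀ n m k t → Enumerates _==Ω_ (allΩ n m k t)
  enumerates-allΩ n m k t =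
    enumerates-cartesianProduct {eq₁ = _==ᶠ_} {test (Vec.≡-dec _≟ᶜ_)}
                                {allFormulas n m k} {allVecs t (allChoices m k)}
      (enumerates-allFuns m {pointwise _==ᴸ_} {allFuns k (allLits n)}
        (enumerates-allFuns k {_==ᴸ_} {allLits n} (enumerates-allLits n)))
      (enumerates-allVecs t {_≟_ = _≟ᶜ_} {allChoices m k} (enumerates-allChoices m k))

  if-nonNeg : ∀ b {p q} → 0ℚ ≤ p → 0ℚ ≤ q → 0ℚ ≤ (if b then p else q)
  if-nonNeg true  0≤p 0≤q = 0≤p
  if-nonNeg false 0≤p 0≤q = 0≤q

  inv-nonNeg : ∀ d → 0ℚ ≤ inv d
  inv-nonNeg zero    = ≤-refl
  inv-nonNeg (suc d) = nonNegative⁻¹ (inv (suc d)) {{normalize-nonNeg 1 (suc d)}}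

  weight-nonNeg : (ω : Ω n m k t) → 0ℚ ≤ weight ω
  weight-nonNeg {n = n} {m} {k} (Φ , cs) =
    *-nonNeg (inv-nonNeg ((2 * n) ^ (k * m))) (weightFrom-nonNeg (Walk.initial Φ) (Vec.toList cs))
    where
    open Walk Φ
    stepW-nonNeg : ∀ s c → 0ℚ ≤ stepW s c
    stepW-nonNeg s nothing        = if-nonNeg (formSat (State.σ s)) 0≤1 ≤-refl
    stepW-nonNeg s (just (i , j)) = if-nonNeg (formSat (State.σ s)) ≤-refl
      (if-nonNeg (clauseSat (State.σ s) i) ≤-refl (inv-nonNeg (unsat (State.σ s) * k)))
    weightFrom-nonNeg : ∀ s cs → 0ℚ ≤ weightFrom s cs
    weightFrom-nonNeg s []       = 0≤1
    weightFrom-nonNeg s (c ∷ cs) = *-nonNeg (stepW-nonNeg s c) (weightFrom-nonNeg (step s c) cs)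

  record InEvent (I : IndexSet m k) (ω : Ω n m k (suc t)) : Set where
    field
      i₀    : Fin m
      j₀    : Fin k
      last≡ : State.last (stateAt (suc t) ω) ≡ just (i₀ , j₀)
      on-I  : ∀ i j → I i j ≡ true → Walk.var (proj₁ ω) i j ≡ Walk.var (proj₁ ω) i₀ j₀
      fresh : Walk.var (proj₁ ω) i₀ j₀ ∉ revealed (stateAt t ω)
      off-I : I i₀ j₀ ≡ false

  inEvent : (I : IndexSet m k) (ω : Ω n m k (suc t)) → Estar (suc t) I ω ≡ true → InEvent I ω
  inEvent {t = t} I ω@(Φ , cs) holds with State.last (stateAt (suc t) ω) in last≡
  ... | just (i₀ , j₀) = record
    { i₀ = i₀ ; j₀ = j₀ ; last≡ = last≡
    ; on-I  = on-I
    ; fresh = λ x∈ → case trans (sym (cong not (∈⇒lookup x∈))) fresh-part of λ ()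
    ; off-I = not-true (∧-conicalʳ P₂ P₃ rest)
    }
    where
    x : Fin _
    x = Walk.var Φ i₀ j₀
    P₁ P₂ P₃ : Bool
    P₁ = allF (λ i → allF (λ j → not (I i j) ∨ ⌊ Walk.var Φ i j Fin.≟ x ⌋))
    P₂ = not (lookup (revealed (stateAt t ω)) x)
    P₃ = not (I i₀ j₀)
    rest : P₂ ∧ P₃ ≡ true
    rest = ∧-conicalʳ P₁ (P₂ ∧ P₃) holds
    fresh-part : P₂ ≡ true
    fresh-part = ∧-conicalˡ P₂ P₃ rest
    not-true : ∀ {b} → not b ≡ true → b ≡ false
    not-true {false} _ = refl
    on-I : ∀ i j → I i j ≡ true → Walk.var Φ i j ≡ x
    on-I i j Iij with allF⁻ (allF⁻ (∧-conicalˡ P₁ (P₂ ∧ P₃) holds) i) j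
    ... | tested rewrite Iij = ⌊⌋-true⁻ (Walk.var Φ i j Fin.≟ x) tested

module Switching where

  open import Data.Bool using (Bool; true; false; if_then_else_; not; _∧_)
  open import Data.Bool.Properties using (T-≡; T?; ∧-conicalˡ; ∧-conicalʳ)
  open import Data.Empty using (⊥-elim)
  open import Data.Fin using (Fin; zero)
  import Data.Fin.Properties as Fin
  open import Data.Fin.Subset using (Subset; ∁; ∣_∣; _∉_)
  open import Data.List using (List; []; _∷_; allFin; filterᵇ; cartesianProduct)
  open import Data.List.Membership.Propositional using () renaming (_∈_ to _∈ˡ_)
  open import Data.List.Membership.Propositional.Properties using (∈-filter⁻; ∈-cartesianProduct⁻)
  open import Data.List.Relation.Unary.Any using (here)
  open import Data.Maybe using (maybe′)
  open import Data.Nat as ℕ using (ℕ; zero; suc; _^_; _⊔_)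
  import Data.Nat.Properties as ℕ
  open import Data.Product using (_×_; _,_; proj₁; proj₂)
  open import Data.Rational using (ℚ; 0ℚ; 1ℚ; _+_; _*_; _≤_; _<_)
  open import Data.Rational.Properties
  open import Data.Sum using (inj₁; inj₂)
  open import Data.Vec using ([]; lookup)
  import Data.Vec.Properties as Vec
  open import Function using (_∘_; Equivalence)
  open import Relation.Binary.PropositionalEquality
  open import Defs
  open Sums
  open Counting
  open WalkProperties
  open Outcomes

  module _ {n m k t : ℕ} (I : IndexSet m k) (ω : Ω n m k (suc t)) where

    U : Subset n
    U = revealed (stateAt t ω)

    switchVars : Formula n m k → (Fin m → Fin k → Fin n) → Formula n m k
    switchVars Φ g i j = if I i j then (g i j , proj₂ (Φ i j)) else Φ i j

    Avoids : (Fin m → Fin k → Fin n) → Set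
    Avoids g = ∀ i j → I i j ≡ true → g i j ∉ U

    record Switched (ω′ ω″ : Ω n m k (suc t)) : Set where
      field
        weight≡ : weight ω″ ≡ weight ω′
        same    : sameHist t ω ω″ ≡ true
        last≡   : State.last (stateAt (suc t) ω″) ≡ State.last (stateAt (suc t) ω′)

    -- The walk never looks at the variables at positions in I before time t+1: they equal the freshly
    -- revealed variable, which was outside 𝒜 ∪ 𝒩 until then.
    switch : ∀ {ω′} → InEvent I ω′ → sameHist t ω ω′ ≡ true → ∀ {g} → Avoids g →
             ∀ Φ″ → (∀ i j → Φ″ i j ≡ switchVars (proj₁ ω′) g i j) → Switched ω′ (Φ″ , proj₂ ω′)
    switch {ω′@(Φ′ , cs)} happened same {g} avoids Φ″ Φ″≗ = record
      { weight≡ = weight-switched ; same = same″ ; last≡ = last-switched }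
      where
      open InEvent happened using (on-I; fresh)
      U′ : Subset n
      U′ = revealed (stateAt t ω′)
      U′≡U : U′ ≡ U
      U′≡U = sameHist-revealed t ω ω′ same
      agree : Agree U′ Φ′ Φ″
      agree i j with I i j in Iij | Φ″≗ i j
      ... | false | Φ″≡ = sym (cong proj₂ Φ″≡) , inj₁ (sym (cong proj₁ Φ″≡))
      ... | true  | Φ″≡ = sym (cong proj₂ Φ″≡) ,
        inj₂ ( subst (_∉ U′) (sym (on-I i j Iij)) fresh
             , subst (_∉ U′) (sym (cong proj₁ Φ″≡)) (subst (g i j ∉_) (sym U′≡U) (avoids i j Iij)))
      open Locality Φ′ Φ″ agree
      initial≈ : Walk.initial Φ′ ≈ₛ Walk.initial Φ″
      initial≈ = record { σ≡ = refl ; A≡ = refl ; N≡ = refl ; Z≡ = refl ; last≡ = refl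
                        ; π≗ = λ i j → cong inj₂ (proj₁ (agree i j)) }
      open RunsAgree (run-agree (prefix cs) (invariant-initial Φ′) initial≈ (λ v∈ → v∈))
      at-t : Invariant Φ′ (stateAt t ω′)
      at-t = invariant-stateAt t ω′
      c : Choice m k
      c = lastEntry cs
      norm : ℚ
      norm = inv ((2 ℕ.* n) ^ (k ℕ.* m))
      weight-switched : weight (Φ″ , cs) ≡ weight ω′
      weight-switched = begin
        weight (Φ″ , cs)
          ≡⟨ weight-suc (Φ″ , cs) ⟩
        norm * (Walk.weightFrom Φ″ (Walk.initial Φ″) (prefix cs) * Walk.stepW Φ″ (stateAt t (Φ″ , cs)) c)
          ≡⟨ cong (norm *_) (sym (cong₂ _*_ weight≡ (stepW-agree at-t (λ v∈ → v∈) (_≈ₛ_.σ≡ final≈) c))) ⟩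
        norm * (Walk.weightFrom Φ′ (Walk.initial Φ′) (prefix cs) * Walk.stepW Φ′ (stateAt t ω′) c)
          ≡⟨ sym (weight-suc ω′) ⟩
        weight ω′ ∎
        where open ≡-Reasoning
      same″ : sameHist t ω (Φ″ , cs) ≡ true
      same″ = ⌊⌋-true⁺ (history t (Φ″ , cs) ≟Hist history t ω)
                       (trans (sym trace≡) (⌊⌋-true⁻ (history t ω′ ≟Hist history t ω) same))
      last-switched : State.last (stateAt (suc t) (Φ″ , cs)) ≡ State.last (stateAt (suc t) ω′)
      last-switched = trans (cong State.last (stateAt-suc (Φ″ , cs)))
        (trans (sym (last-step-agree c at-t final≈ (λ v∈ → v∈))) (sym (cong State.last (stateAt-suc ω′))))

    eventMass historyMass : Ω n m k (suc t) → ℚ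
    eventMass   ω′ = if Estar (suc t) I ω′ ∧ sameHist t ω ω′ then weight ω′ else 0ℚ
    historyMass ω″ = if sameHist t ω ω″ then weight ω″ else 0ℚ

    eventMass≤historyMass : ∀ ω′ → eventMass ω′ ≤ historyMass ω′
    eventMass≤historyMass ω′ with Estar (suc t) I ω′
    ... | true  = ≤-refl
    ... | false = if-nonNeg (sameHist t ω ω′) (weight-nonNeg ω′) ≤-refl

    eventMass-positive : ∀ ω′ → 0ℚ < eventMass ω′ → Estar (suc t) I ω′ ∧ sameHist t ω ω′ ≡ true
    eventMass-positive ω′ 0<mass with Estar (suc t) I ω′ ∧ sameHist t ω ω′
    ... | true  = refl
    ... | false = ⊥-elim (<-irrefl refl 0<mass)

    module WithFreeVariable (x₀ : Fin n) where

      free : List (Fin n)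
      free = filterᵇ (λ v → not (lookup U v)) (allFin n)

      -- x₀ is a dummy value off I, so that the switches are total functions
      options : Fin m → Fin k → List (Fin n)
      options i j = if I i j then free else x₀ ∷ []

      switches : List (Fin m → Fin k → Fin n)
      switches = allFunsIn m (λ i → allFunsIn k (options i))

      ∈-switches : ∀ {g} → g ∈ˡ switches → Avoids g × (∀ i j → I i j ≡ false → g i j ≡ x₀)
      ∈-switches {g} g∈ = avoids , off-I
        where
        in-options : ∀ i j → g i j ∈ˡ options i j
        in-options i j = ∈-allFunsIn k (options i) (∈-allFunsIn m (λ i → allFunsIn k (options i)) g∈ i) j
        avoids : Avoids g
        avoids i j Iij g∈U
          with _ , kept ← ∈-filter⁻ (T? ∘ (λ v → not (lookup U v))) {xs = allFin n}
                                    (subst (λ b → g i j ∈ˡ (if b then free else x₀ ∷ [])) Iij (in-options i j))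
          with () ← trans (sym (Equivalence.to T-≡ kept)) (cong not (∈⇒lookup g∈U))
        off-I : ∀ i j → I i j ≡ false → g i j ≡ x₀
        off-I i j ¬Iij with subst (λ b → g i j ∈ˡ (if b then free else x₀ ∷ [])) ¬Iij (in-options i j)
        ... | here g≡x₀ = g≡x₀

      _==ᴳ_ : (Fin m → Fin k → Fin n) → (Fin m → Fin k → Fin n) → Bool
      _==ᴳ_ = pointwise (pointwise (test Fin._≟_))

      switches-once : ∀ g → mult _==ᴳ_ switches g ≤ 1ℚ
      switches-once g = begin
        mult _==ᴳ_ switches g
          ≡⟨ mult-allFunsIn m (pointwise (test Fin._≟_)) (λ i → allFunsIn k (options i)) g ⟩
        ∏ m (λ i → mult (pointwise (test Fin._≟_)) (allFunsIn k (options i)) (g i))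
          ≡⟨ ∏-cong m (λ i → mult-allFunsIn k (test Fin._≟_) (options i) (g i)) ⟩
        ∏ m (λ i → ∏ k (λ j → mult (test Fin._≟_) (options i j) (g i j)))
          ≤⟨ ∏-≤1 m (λ i → ∏-nonNeg k (mult-nonNeg i)) (λ i → ∏-≤1 k (mult-nonNeg i) (at-most-once i)) ⟩
        1ℚ ∎
        where
        open ≤-Reasoning
        mult-nonNeg : ∀ i j → 0ℚ ≤ mult (test Fin._≟_) (options i j) (g i j)
        mult-nonNeg i j = Σℚ-nonNeg (options i j) (λ v → 𝟙-nonNeg (test Fin._≟_ v (g i j)))
        at-most-once : ∀ i j → mult (test Fin._≟_) (options i j) (g i j) ≤ 1ℚ
        at-most-once i j with I i j
        ... | true  = ≤-trans (mult-filterᵇ (test Fin._≟_) (λ v → not (lookup U v)) (allFin n) (g i j))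
                              (≤-reflexive (enumerates-allFin n (g i j)))
        ... | false = ≤-trans (≤-reflexive (+-identityʳ _)) (𝟙-≤1 (test Fin._≟_ x₀ (g i j)))

      card-free : Σℚ free (λ _ → 1ℚ) ≡ ℕtoℚ ∣ ∁ U ∣
      card-free = trans (Σℚ-filterᵇ (λ v → not (lookup U v)) (allFin n) (λ _ → 1ℚ)) (sym (ℕtoℚ-∣∁∣ U))

      card-switches : Σℚ switches (λ _ → 1ℚ) ≡ ℕtoℚ (∣ ∁ U ∣ ^ size I)
      card-switches = begin
        Σℚ switches (λ _ → 1ℚ)
          ≡⟨ card-allFunsIn m (λ i → allFunsIn k (options i)) ⟩
        ∏ m (λ i → Σℚ (allFunsIn k (options i)) (λ _ → 1ℚ))
          ≡⟨ ∏-cong m (λ i → card-allFunsIn k (options i)) ⟩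
        ∏ m (λ i → ∏ k (λ j → Σℚ (options i j) (λ _ → 1ℚ)))
          ≡⟨ ∏-cong m (λ i → ∏-cong k (λ j → card-options (I i j))) ⟩
        ∏ m (λ i → ∏ k (λ j → if I i j then ℕtoℚ ∣ ∁ U ∣ else 1ℚ))
          ≡⟨ ∏-cong m (λ i → trans (∏-cong k (λ j → sym (ℕtoℚ-^-indicator ∣ ∁ U ∣ (I i j))))
                                   (sym (ℕtoℚ-^-sum ∣ ∁ U ∣ k (λ j → if I i j then 1 else 0)))) ⟩
        ∏ m (λ i → ℕtoℚ (∣ ∁ U ∣ ^ countFin (I i)))
          ≡⟨ sym (ℕtoℚ-^-sum ∣ ∁ U ∣ m (λ i → countFin (I i))) ⟩
        ℕtoℚ (∣ ∁ U ∣ ^ size I) ∎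
        where
        open ≡-Reasoning
        card-options : ∀ b → Σℚ (if b then free else x₀ ∷ []) (λ _ → 1ℚ) ≡ (if b then ℕtoℚ ∣ ∁ U ∣ else 1ℚ)
        card-options true  = card-free
        card-options false = +-identityʳ 1ℚ

      doSwitch : Ω n m k (suc t) × (Fin m → Fin k → Fin n) → Ω n m k (suc t)
      doSwitch ((Φ′ , cs) , g) = switchVars Φ′ g , cs

      lastVar : Ω n m k (suc t) → Fin n
      lastVar ω″ = maybe′ (λ p → Walk.var (proj₁ ω″) (proj₁ p) (proj₂ p)) x₀ (State.last (stateAt (suc t) ω″))

      -- Positions in I are restored to the variable of the last flip, whose own position is off I.
      undoSwitch : Ω n m k (suc t) → Ω n m k (suc t) × (Fin m → Fin k → Fin n)
      undoSwitch ω″@(Φ″ , cs) =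
        ((λ i j → if I i j then (lastVar ω″ , proj₂ (Φ″ i j)) else Φ″ i j) , cs) ,
        (λ i j → if I i j then proj₁ (Φ″ i j) else x₀)

      _==ˣ_ : Ω n m k (suc t) × (Fin m → Fin k → Fin n) → Ω n m k (suc t) × (Fin m → Fin k → Fin n) → Bool
      _==ˣ_ = _==Ω_ ⊗ _==ᴳ_

      undoSwitch-doSwitch : ∀ Φ′ cs g → g ∈ˡ switches →
        Estar (suc t) I (Φ′ , cs) ∧ sameHist t ω (Φ′ , cs) ≡ true →
        ∀ Φ″ → (∀ i j → Φ″ i j ≡ switchVars Φ′ g i j) →
        ((Φ′ , cs) , g) ==ˣ undoSwitch (Φ″ , cs) ≡ true × eventMass (Φ′ , cs) ≡ historyMass (Φ″ , cs)
      undoSwitch-doSwitch Φ′ cs g g∈ E∧same Φ″ Φ″≗ =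
        cong₂ _∧_ (cong₂ _∧_ (pointwise²⁺ {_==_ = _==ᴸ_} ==ᴸ-refl restored) (test-refl (Vec.≡-dec _≟ᶜ_) cs))
                  (pointwise²⁺ {_==_ = test Fin._≟_} (test-refl Fin._≟_) extracted) ,
        trans (cong (λ b → if b then weight (Φ′ , cs) else 0ℚ) E∧same)
              (sym (trans (cong (λ b → if b then weight (Φ″ , cs) else 0ℚ) same″) weight≡))
        where
        E S : Bool
        E = Estar (suc t) I (Φ′ , cs)
        S = sameHist t ω (Φ′ , cs)
        happened : InEvent I (Φ′ , cs)
        happened = inEvent I (Φ′ , cs) (∧-conicalˡ E S E∧same)
        open InEvent happened using (i₀; j₀; on-I; off-I) renaming (last≡ to last≡′)
        open Switched (switch happened (∧-conicalʳ E S E∧same) (proj₁ (∈-switches g∈)) Φ″ Φ″≗)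
          renaming (same to same″)
        lastVar≡ : lastVar (Φ″ , cs) ≡ Walk.var Φ′ i₀ j₀
        lastVar≡ = trans (cong (maybe′ (λ p → Walk.var Φ″ (proj₁ p) (proj₂ p)) x₀) (trans last≡ last≡′))
                         (cong proj₁ unswitched-at-last)
          where
          unswitched-at-last : Φ″ i₀ j₀ ≡ Φ′ i₀ j₀
          unswitched-at-last =
            trans (Φ″≗ i₀ j₀) (cong (λ b → if b then (g i₀ j₀ , proj₂ (Φ′ i₀ j₀)) else Φ′ i₀ j₀) off-I)
        restored : ∀ i j → Φ′ i j ≡ proj₁ (proj₁ (undoSwitch (Φ″ , cs))) i j
        restored i j with I i j in Iij | Φ″≗ i j
        ... | true  | Φ″≡ = cong₂ _,_ (trans (on-I i j Iij) (sym lastVar≡)) (sym (cong proj₂ Φ″≡))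
        ... | false | Φ″≡ = sym Φ″≡
        extracted : ∀ i j → g i j ≡ proj₂ (undoSwitch (Φ″ , cs)) i j
        extracted i j with I i j in Iij | Φ″≗ i j
        ... | true  | Φ″≡ = sym (cong proj₁ Φ″≡)
        ... | false | _   = proj₂ (∈-switches g∈) i j Iij

      decode : ∀ x → x ∈ˡ cartesianProduct (allΩ n m k (suc t)) switches → 0ℚ < eventMass (proj₁ x) →
               ∀ ω″ → ω″ ==Ω doSwitch x ≡ true →
               x ==ˣ undoSwitch ω″ ≡ true × eventMass (proj₁ x) ≤ historyMass ω″
      decode ((Φ′ , cs) , g) x∈ 0<mass (Φ″ , cs″) ω″≈
        with refl ← test-sound (Vec.≡-dec _≟ᶜ_) {cs″} {cs} (∧-conicalʳ (Φ″ ==ᶠ switchVars Φ′ g) _ ω″≈)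
        with undone , mass≡ ← undoSwitch-doSwitch Φ′ cs g
                                (proj₂ (∈-cartesianProduct⁻ (allΩ n m k (suc t)) switches x∈))
                                (eventMass-positive (Φ′ , cs) 0<mass) Φ″
                                (pointwise²⁻ ==ᴸ-sound (∧-conicalˡ (Φ″ ==ᶠ switchVars Φ′ g) _ ω″≈))
        = undone , ≤-reflexive mass≡

      switching-bound : Pr (λ ω′ → Estar (suc t) I ω′ ∧ sameHist t ω ω′) * ℕtoℚ (∣ ∁ U ∣ ^ size I)
                        ≤ Pr (sameHist t ω)
      switching-bound = begin
        Σℚ Ωs eventMass * ℕtoℚ (∣ ∁ U ∣ ^ size I)              ≡⟨ cong (Σℚ Ωs eventMass *_) (sym card-switches) ⟩
        Σℚ Ωs eventMass * Σℚ switches (λ _ → 1ℚ)               ≡⟨ Σℚ-*ʳ Ωs eventMass _ ⟩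
        Σℚ Ωs (λ ω′ → eventMass ω′ * Σℚ switches (λ _ → 1ℚ))   ≡⟨ Σℚ-cong Ωs copies ⟩
        Σℚ Ωs (λ ω′ → Σℚ switches (λ _ → eventMass ω′))        ≡⟨ Σℚ-cartesianProduct Ωs switches (eventMass ∘ proj₁) ⟨
        Σℚ (cartesianProduct Ωs switches) (eventMass ∘ proj₁)
          ≤⟨ double-counting _==ˣ_ _==Ω_ (cartesianProduct Ωs switches) Ωs doSwitch undoSwitch
               (eventMass ∘ proj₁) historyMass once (enumerates-allΩ n m k (suc t))
               (λ ω″ → if-nonNeg (sameHist t ω ω″) (weight-nonNeg ω″) ≤-refl) decode ⟩
        Σℚ Ωs historyMass ∎
        where
        open ≤-Reasoning
        Ωs : List (Ω n m k (suc t))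
        Ωs = allΩ n m k (suc t)
        copies : ∀ ω′ → eventMass ω′ * Σℚ switches (λ _ → 1ℚ) ≡ Σℚ switches (λ _ → eventMass ω′)
        copies ω′ = trans (Σℚ-*ˡ switches (λ _ → 1ℚ) (eventMass ω′))
                          (Σℚ-cong switches (λ _ → *-identityʳ (eventMass ω′)))
        once : ∀ x → mult _==ˣ_ (cartesianProduct Ωs switches) x ≤ 1ℚ
        once (ω′ , g) = begin
          mult _==ˣ_ (cartesianProduct Ωs switches) (ω′ , g)
            ≡⟨ mult-cartesianProduct _==Ω_ _==ᴳ_ Ωs switches ω′ g ⟩
          mult _==Ω_ Ωs ω′ * mult _==ᴳ_ switches g
            ≡⟨ cong (_* mult _==ᴳ_ switches g) (enumerates-allΩ n m k (suc t) ω′) ⟩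
          1ℚ * mult _==ᴳ_ switches g                        ≡⟨ *-identityˡ _ ⟩
          mult _==ᴳ_ switches g                             ≤⟨ switches-once g ⟩
          1ℚ ∎

    bound-⊔ : ∀ d → ∣ ∁ U ∣ ≡ d →
              Pr (λ ω′ → Estar (suc t) I ω′ ∧ sameHist t ω ω′) * ℕtoℚ ((1 ⊔ d) ^ size I) ≤ Pr (sameHist t ω)
    bound-⊔ zero _ = begin
      Pr E * ℕtoℚ (1 ^ size I) ≡⟨ cong (λ z → Pr E * ℕtoℚ z) (ℕ.^-zeroˡ (size I)) ⟩
      Pr E * 1ℚ                ≡⟨ *-identityʳ (Pr E) ⟩
      Pr E                     ≤⟨ Σℚ-mono (allΩ n m k (suc t)) eventMass≤historyMass ⟩
      Pr (sameHist t ω)        ∎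
      where
      open ≤-Reasoning
      E : Ω n m k (suc t) → Bool
      E ω′ = Estar (suc t) I ω′ ∧ sameHist t ω ω′
    bound-⊔ (suc d) ∣∁U∣≡ =
      subst (λ d → Pr (λ ω′ → Estar (suc t) I ω′ ∧ sameHist t ω ω′) * ℕtoℚ (d ^ size I) ≤ Pr (sameHist t ω))
            ∣∁U∣≡ (WithFreeVariable.switching-bound (element {S = ∁ U} ∣∁U∣≡))
      where
      element : ∀ {n} {S : Subset n} → ∣ S ∣ ≡ suc d → Fin n
      element {zero} {[]} ()
      element {suc n} _ = zero

  event-bound : ∀ {n m k} t → 1 ℕ.≤ t → (I : IndexSet m k) (ω : Ω n m k t) →
    Pr (λ ω′ → Estar t I ω′ ∧ sameHist (t ℕ.∸ 1) ω ω′) * ℕtoℚ (bound t ω ^ size I)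
      ≤ Pr (sameHist (t ℕ.∸ 1) ω)
  event-bound (suc t) _ I ω = bound-⊔ I ω _ refl

open import Defs
open import Data.Bool using (_∧_)
open import Data.Nat using (ℕ; _≤_; _∸_; _^_; _*_)
open import Data.Integer using (+_)
open import Data.Rational using (ℚ; 0ℚ; ceiling) renaming (_≤_ to _≤ℚ_; _<_ to _<ℚ_; _*_ to _*ℚ_)
open import Data.Product using (∃-syntax; _,_)
open import Relation.Binary.PropositionalEquality using (_≡_)

lemma5 : ∃[ k₀ ] ∀ (k : ℕ) → k₀ ≤ k → ∀ (n : ℕ) (ρ : ℚ) → inv (k * k) ≤ℚ ρ → ρ <ℚ inv 25 →
         ∀ (m : ℕ) → + m ≡ ⌈ ρ *ℚ ℕtoℚ (2 ^ k * n) *ℚ inv k ⌉ →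
         ∀ (t : ℕ) → 1 ≤ t → ∀ (I : IndexSet m k) → NonEmpty I →
         ∀ (ω : Ω n m k t) → 0ℚ <ℚ weight ω →
         Pr (λ ω′ → Estar t I ω′ ∧ sameHist (t ∸ 1) ω ω′) *ℚ ℕtoℚ (bound t ω ^ size I)
           ≤ℚ Pr (sameHist (t ∸ 1) ω)
lemma5 = 0 , λ k _ n ρ _ _ m _ t 1≤t I _ ω _ → Switching.event-bound t 1≤t I ω
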